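{- Let $G$ be a finite simple graph, let $d\ge 1$ and let $r_1,\dots,r_d\ge 2$ be integers, and let $H=K_{r_1}\,\square\,K_{r_2}\,\square\cdots\square\, K_{r_d}$ be the Cartesian product of complete graphs. Let the distinct values occurring among $r_1,\dots,r_d$ be $s_1,\dots,s_\ell$, and let $m_j$ be the number of indices $i$ with $r_i=s_j$. For every ordered $d$-tuple $\mathbf{x}=(v_1,\dots,v_d)$ of distinct vertices of $G$, let $G_{\mathbf{x}}$ be the graph obtained from $G$ by replacing each $v_i$ with a clique on new vertices $v_{i,1},\dots,v_{i,r_i}$, where: edges between vertices of $V(G)\setminus\{v_1,\dots,v_d\}$ are as in $G$; each $v_{i,j}$ is adjacent to every $w\in V(G)\setminus\{v_1,\dots,v_d\}$ with $v_iw\in E(G)$; for $i\ne i'$, $v_{i,j}v_{i',j'}$ is an edge (for all $j,j'$) iff $v_iv_{i'}\in E(G)$. Then for every positive integer $k$, $$\pi_G^{(H)}(k) = \frac{1}{\prod_{i=1}^d r_i!\cdot\prod_{j=1}^{\ell} m_j!}\sum_{\mathbf{x}} \pi_{G_{\mathbf{x}}}(k),$$ where the sum ranges over all ordered $d$-tuples $\mathbf{x}$ of distinct vertices of $G$.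
   Context: For a positive integer $k$, a proper $k$-coloring of $G$ is a map $V(G)\to\{1,\dots,k\}$ giving adjacent vertices different colors; $\pi_G(k)$ is the number of proper $k$-colorings. The $k$-coloring graph $\mathcal{C}_k(G)$ has the proper $k$-colorings of $G$ as vertices, two colorings adjacent iff they differ in the color of exactly one vertex. For a graph $H$, $\pi_G^{(H)}(k)$ is the number of vertex subsets $U$ of $\mathcal{C}_k(G)$ whose induced subgraph is isomorphic to $H$. The Cartesian product $A\,\square\,B$ has vertex set $V(A)\times V(B)$, with $(a,b)\sim(a',b')$ iff ($a=a'$ and $bb'\in E(B)$) or ($b=b'$ and $aa'\in E(A)$). -}

module Defs where

open import Data.Nat using (ℕ; zero; suc; _+_; _*_; _!)
open import Data.Nat.Properties using () renaming (_≟_ to _≟ℕ_)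
open import Data.Bool using (Bool; true; false; T; if_then_else_; not)
open import Data.Fin using (Fin; toℕ; _≟_)
open import Data.Fin.Properties using (all?)
open import Data.Vec using (Vec; []; _∷_; lookup; toList)
open import Data.Vec.Membership.Propositional using (_∈_)
import Data.Vec.Membership.DecPropositional as VecMem
open import Data.List using (List; length; map; filter; allFin; concatMap; _++_; deduplicate)
open import Data.Nat.ListAction using (sum; product)
import Data.List as List
open import Data.Product using (Σ; _×_; _,_; proj₁)
open import Data.Sum using (_⊎_)
open import Function.Bundles using (_↔_; Inverse)
open import Relation.Nullary using (Dec; ¬_; ¬?)
open import Relation.Nullary.Decidable using (⌊_⌋; _→-dec_; T?)
open import Relation.Binary.PropositionalEquality using (_≡_; _≢_)

record Graph : Set where
  field
    n   : ℕ
    adj : Fin n → Fin n → Bool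
open Graph public

SimpleGraph : Graph → Set
SimpleGraph G = (∀ u v → adj G u v ≡ adj G v u) × (∀ v → adj G v v ≡ false)

Proper : (G : Graph) {k : ℕ} → Vec (Fin k) (n G) → Set
Proper G c = ∀ u v → T (adj G u v) → lookup c u ≢ lookup c v

proper? : (G : Graph) {k : ℕ} (c : Vec (Fin k) (n G)) → Dec (Proper G c)
proper? G c = all? λ u → all? λ v → T? (adj G u v) →-dec ¬? (lookup c u ≟ lookup c v)

sumVec : {m : ℕ} (d : ℕ) → (Vec (Fin m) d → ℕ) → ℕ
sumVec zero    f = f []
sumVec {m} (suc d) f = sum (map (λ a → sumVec d (λ v → f (a ∷ v))) (allFin m))

π : Graph → ℕ → ℕ
π G k = sumVec (n G) (λ c → if ⌊ proper? G {k} c ⌋ then 1 else 0)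

-- Cardinality of a (not necessarily propositional) predicate P on A:
-- there are exactly c pairwise distinct a with P a (inhabited).

HasCard : {A : Set} → (A → Set) → ℕ → Set
HasCard {A} P c =
  Σ (Vec A c) λ xs →
    (∀ i j → lookup xs i ≡ lookup xs j → i ≡ j) ×
    (∀ a → (a ∈ xs → P a) × (P a → a ∈ xs))

record Gr : Set₁ where
  field
    V : Set
    E : V → V → Set
open Gr public

Iso : Gr → Gr → Set
Iso A B = Σ (V A ↔ V B) λ f →
  ∀ a b → (E A a b → E B (Inverse.to f a) (Inverse.to f b))
        × (E B (Inverse.to f a) (Inverse.to f b) → E A a b)

K : ℕ → Gr
K r = record { V = Fin r ; E = λ a b → a ≢ b }

_□_ : Gr → Gr → Gr
A □ B = record
  { V = V A × V B
  ; E = λ { (a , b) (a' , b') → (a ≡ a' × E B b b') ⊎ (b ≡ b' × E A a a') } }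

-- H = K_{r₁} □ K_{r₂} □ ⋯ □ K_{r_d}  (the case d = 0 is never used)
Hgraph : {d : ℕ} → Vec ℕ d → Gr
Hgraph []             = K 1
Hgraph (r ∷ [])       = K r
Hgraph (r ∷ r' ∷ rs)  = K r □ Hgraph (r' ∷ rs)

-- Vertex subsets of C_k(G): canonical representation of a subset of
-- Vec (Fin k) n as a k-ary tree of depth n with Boolean leaves.

Tab : ℕ → ℕ → Set
Tab k zero    = Bool
Tab k (suc m) = Vec (Tab k m) k

mem : {k m : ℕ} → Tab k m → Vec (Fin k) m → Bool
mem {m = zero}  b []      = b
mem {m = suc m} t (a ∷ c) = mem (lookup t a) c

AdjC : {k m : ℕ} → Vec (Fin k) m → Vec (Fin k) m → Set
AdjC {m = m} c c' = Σ (Fin m) λ v →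
  lookup c v ≢ lookup c' v × (∀ w → w ≢ v → lookup c w ≡ lookup c' w)

Induced : (G : Graph) (k : ℕ) → Tab k (n G) → Gr
Induced G k U = record
  { V = Σ (Vec (Fin k) (n G)) (λ c → T (mem U c))
  ; E = λ a b → AdjC (proj₁ a) (proj₁ b) }

InducesH : (G : Graph) (k : ℕ) {d : ℕ} (rs : Vec ℕ d) → Tab k (n G) → Set
InducesH G k rs U =
  (∀ c → T (mem U c) → Proper G c) × Iso (Hgraph rs) (Induced G k U)

Distinct : {A : Set} {d : ℕ} → Vec A d → Set
Distinct {d = d} x = ∀ i j → lookup x i ≡ lookup x j → i ≡ j

distinct? : {m d : ℕ} (x : Vec (Fin m) d) → Dec (Distinct x)
distinct? x = all? λ i → all? λ j → (lookup x i ≟ lookup x j) →-dec (i ≟ j)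

data Label (m d : ℕ) (rs : Vec ℕ d) : Set where
  old : Fin m → Label m d rs
  new : (i : Fin d) → Fin (lookup rs i) → Label m d rs

module _ (G : Graph) {d : ℕ} (rs : Vec ℕ d) (x : Vec (Fin (n G)) d) where
  open VecMem (_≟_ {n G}) using (_∈?_)

  labels : List (Label (n G) d rs)
  labels = map old (filter (λ w → ¬? (w ∈? x)) (allFin (n G)))
        ++ concatMap (λ i → map (new i) (allFin (lookup rs i))) (allFin d)

  adjL : Label (n G) d rs → Label (n G) d rs → Bool
  adjL (old w)   (old w')    = adj G w w'
  adjL (old w)   (new i j)   = adj G w (lookup x i)
  adjL (new i j) (old w)     = adj G (lookup x i) w
  adjL (new i j) (new i' j') =
    if ⌊ i ≟ i' ⌋ then not ⌊ toℕ j ≟ℕ toℕ j' ⌋ else adj G (lookup x i) (lookup x i')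

  Gx : Graph
  Gx = record { n = length labels
              ; adj = λ p q → adjL (List.lookup labels p) (List.lookup labels q) }

multiplicity : {d : ℕ} → Vec ℕ d → ℕ → ℕ
multiplicity rs s = length (filter (λ r → s ≟ℕ r) (toList rs))

denom : {d : ℕ} → Vec ℕ d → ℕ
denom rs = product (map _! (toList rs))
         * product (map (λ s → multiplicity rs s !) (deduplicate _≟ℕ_ (toList rs)))

{-# OPTIONS --safe #-}
-- A frame consists of distinct vertices x₁ … x_d of G, a coloring b of G, and injective palettes
-- sᵢ of rᵢ colors; its box is the set of colorings that agree with b off the xᵢ and color each xᵢ
-- from sᵢ. A box induces a copy of H = K_{r₁} □ ⋯ □ K_{r_d} in the coloring graph. Conversely, in an
-- induced copy of H, changing the i-th coordinate always recolors one and the same vertex, because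
-- triangles and induced 4-cycles of the Hamming graph force neighboring coordinate changes onto
-- fixed positions; hence every induced copy is a box. Once b is normalized on the xᵢ, a box
-- determines its frame up to permuting positions of equal size and permuting each palette, i.e. it has
-- exactly ∏ rᵢ! · ∏ mⱼ! frames. Frames with fixed positions x whose boxes consist of proper colorings
-- correspond to proper colorings of G_x (the clique replacing vᵢ is colored by sᵢ), so double
-- counting frames gives the identity.
module Submission where

open import Defs
open import Data.Bool using (Bool; true; false; T; not; if_then_else_)
import Data.Bool.Properties as Boolₚ
open import Data.Empty using (⊥; ⊥-elim)
open import Data.Fin using (Fin; zero; suc; toℕ)
import Data.Fin.Properties as Finₚ
open import Data.List as List using (List; []; _∷_; map; _++_; filter; concatMap; allFin; length)
open import Data.List.Membership.Propositional using () renaming (_∈_ to _∈ₗ_)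
open import Data.List.Relation.Unary.Any using (here; there)
open import Data.List.Membership.Propositional.Properties using (∈-filter⁺; ∈-filter⁻)
open import Data.Vec.Membership.Propositional.Properties using (∈-fromList⁺; ∈-fromList⁻)
import Data.List.Relation.Unary.All as ListAll
import Data.List.Properties as Listₚ
open import Data.Nat using (ℕ; zero; suc; _≡ᵇ_; _+_; _*_; _^_; _≤_; z≤n; s≤s; _!)
open import Data.Nat.ListAction using (sum; product)
open import Data.Nat.Properties
  using (+-identityʳ; +-assoc; +-comm; *-identityˡ; *-identityʳ; *-zeroʳ; *-comm; *-assoc;
         *-distribˡ-+; +-mono-≤; ≤-reflexive; ≤-trans; m≤n+m; +-cancelʳ-≡)
import Data.Nat.Properties as ℕₚ
open import Data.Product using (Σ; ∃; _×_; _,_; proj₁; proj₂)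
open import Data.Product.Properties using (≡-dec; ,-injective)
open import Data.Sum using (_⊎_; inj₁; inj₂)
open import Data.Vec as Vec using (Vec; []; _∷_; lookup; tabulate)
import Data.Vec.Properties as Vecₚ
open import Data.Vec.Relation.Unary.All using (All; []; _∷_)
import Data.Vec.Relation.Unary.Any as VecAny
import Data.Vec.Membership.DecPropositional as VecMem
open import Data.Unit using (⊤; tt)
open import Function using (_∘_; id)
open import Relation.Binary.Definitions using (DecidableEquality)
open import Relation.Binary.PropositionalEquality
open import Relation.Nullary using (Dec; yes; no; ¬_; does)
open import Algebra.Properties.CommutativeSemigroup ℕₚ.+-commutativeSemigroup
  using () renaming (interchange to +-interchange)
open import Algebra.Properties.CommutativeSemigroup ℕₚ.*-commutativeSemigroup
  using () renaming (x∙yz≈y∙xz to *-left-comm; interchange to *-interchange)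
open import Relation.Nullary.Decidable using (T?; ⌊_⌋; _×-dec_; _→-dec_; ¬?; map′; decidable-stable; dec-true; dec-false; does-⇔)
open import Function.Bundles using (mk⇔; mk↔ₛ′; Inverse; Equivalence)
open import Function.Construct.Composition using (_↔-∘_)
open import Function.Construct.Symmetry using (↔-sym)

private
  variable
    A B P Q : Set

-- does rather than ⌊_⌋: then 𝟙 also computes on decisions built with map′, such as ℕₚ._≟_.
𝟙 : Dec P → ℕ
𝟙 P? = if does P? then 1 else 0

𝟙-yes : (P? : Dec P) → P → 𝟙 P? ≡ 1
𝟙-yes (yes _) _  = refl
𝟙-yes (no ¬p) p = ⊥-elim (¬p p)

𝟙-no : (P? : Dec P) → ¬ P → 𝟙 P? ≡ 0
𝟙-no (yes p) ¬p = ⊥-elim (¬p p)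
𝟙-no (no _)  _  = refl

𝟙-cong : (P? : Dec P) (Q? : Dec Q) → (P → Q) → (Q → P) → 𝟙 P? ≡ 𝟙 Q?
𝟙-cong (yes p) Q? f g = sym (𝟙-yes Q? (f p))
𝟙-cong (no ¬p) Q? f g = sym (𝟙-no Q? (¬p ∘ g))

𝟙-× : (P? : Dec P) (Q? : Dec Q) → 𝟙 (P? ×-dec Q?) ≡ 𝟙 P? * 𝟙 Q?
𝟙-× (yes _) (yes _) = refl
𝟙-× (yes _) (no _)  = refl
𝟙-× (no _)  _       = refl

𝟙≤1 : (P? : Dec P) → 𝟙 P? ≤ 1
𝟙≤1 (yes _) = s≤s z≤n
𝟙≤1 (no _)  = z≤n

𝟙≢0⇒ : (P? : Dec P) → 𝟙 P? ≢ 0 → P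
𝟙≢0⇒ (yes p) _  = p
𝟙≢0⇒ (no _)  ne = ⊥-elim (ne refl)

𝟙*-cong : (P? : Dec P) {m n : ℕ} → (P → m ≡ n) → 𝟙 P? * m ≡ 𝟙 P? * n
𝟙*-cong (yes p) eq = cong (_+ 0) (eq p)
𝟙*-cong (no _)  _  = refl

≡𝟙* : (P? : Dec P) {m n : ℕ} → (P → m ≡ n) → (¬ P → m ≡ 0) → m ≡ 𝟙 P? * n
≡𝟙* (yes p) f _ = trans (f p) (sym (+-identityʳ _))
≡𝟙* (no ¬p) _ g = g ¬p

if-yes : (P? : Dec P) {a b : A} → P → (if ⌊ P? ⌋ then a else b) ≡ a
if-yes (yes _) _  = refl
if-yes (no ¬p) p = ⊥-elim (¬p p)

if-no : (P? : Dec P) {a b : A} → ¬ P → (if ⌊ P? ⌋ then a else b) ≡ b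
if-no (yes p) ¬p = ⊥-elim (¬p p)
if-no (no _)  _  = refl

T-not⌊⌋ : (P? : Dec P) → ¬ P → T (not ⌊ P? ⌋)
T-not⌊⌋ (yes p) ¬p = ¬p p
T-not⌊⌋ (no _)  _  = tt

T-not⌊⌋⁻ : (P? : Dec P) → T (not ⌊ P? ⌋) → ¬ P
T-not⌊⌋⁻ (no ¬p) _ = ¬p

if⌊⌋≡𝟙 : (P? : Dec P) → (if ⌊ P? ⌋ then 1 else 0) ≡ 𝟙 P?
if⌊⌋≡𝟙 (yes _) = refl
if⌊⌋≡𝟙 (no _)  = refl

∑ₗ : List A → (A → ℕ) → ℕ
∑ₗ xs f = sum (map f xs)

syntax ∑ₗ xs (λ a → e) = ∑[ a ← xs ] e

module _ {A : Set} where

  ∑-cong : (xs : List A) {f g : A → ℕ} → (∀ a → f a ≡ g a) → ∑ₗ xs f ≡ ∑ₗ xs g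
  ∑-cong []       eq = refl
  ∑-cong (x ∷ xs) eq = cong₂ _+_ (eq x) (∑-cong xs eq)

  ∑-distrib-+ : (xs : List A) (f g : A → ℕ) → ∑[ a ← xs ] (f a + g a) ≡ ∑ₗ xs f + ∑ₗ xs g
  ∑-distrib-+ []       f g = refl
  ∑-distrib-+ (x ∷ xs) f g =
    trans (cong (f x + g x +_) (∑-distrib-+ xs f g)) (+-interchange (f x) (g x) _ _)

  ∑-*ˡ : (xs : List A) (m : ℕ) (f : A → ℕ) → ∑[ a ← xs ] (m * f a) ≡ m * ∑ₗ xs f
  ∑-*ˡ []       m f = sym (*-zeroʳ m)
  ∑-*ˡ (x ∷ xs) m f = trans (cong (m * f x +_) (∑-*ˡ xs m f)) (sym (*-distribˡ-+ m (f x) _))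

  ∑-*ʳ : (xs : List A) (m : ℕ) (f : A → ℕ) → ∑[ a ← xs ] (f a * m) ≡ ∑ₗ xs f * m
  ∑-*ʳ xs m f = trans (∑-cong xs (λ a → *-comm (f a) m)) (trans (∑-*ˡ xs m f) (*-comm m _))

  ∑-zero : (xs : List A) {f : A → ℕ} → (∀ a → f a ≡ 0) → ∑ₗ xs f ≡ 0
  ∑-zero []       eq = refl
  ∑-zero (x ∷ xs) eq = cong₂ _+_ (eq x) (∑-zero xs eq)

  ∑-++ : (xs ys : List A) (f : A → ℕ) → ∑ₗ (xs ++ ys) f ≡ ∑ₗ xs f + ∑ₗ ys f
  ∑-++ []       ys f = refl
  ∑-++ (x ∷ xs) ys f = trans (cong (f x +_) (∑-++ xs ys f)) (sym (+-assoc (f x) _ _))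

  ∑-mono : (xs : List A) {f g : A → ℕ} → (∀ a → f a ≤ g a) → ∑ₗ xs f ≤ ∑ₗ xs g
  ∑-mono []       le = z≤n
  ∑-mono (x ∷ xs) le = +-mono-≤ (le x) (∑-mono xs le)

  ∑≢0⇒∃ : (xs : List A) (f : A → ℕ) → ∑ₗ xs f ≢ 0 → ∃ λ a → a ∈ₗ xs × f a ≢ 0
  ∑≢0⇒∃ []       f ne = ⊥-elim (ne refl)
  ∑≢0⇒∃ (x ∷ xs) f ne with f x ℕₚ.≟ 0
  ... | no  fx≢0 = x , here refl , fx≢0
  ... | yes fx≡0 =
    let a , a∈xs , fa≢0 = ∑≢0⇒∃ xs f (λ e → ne (trans (cong (_+ ∑ₗ xs f) fx≡0) e))
    in a , there a∈xs , fa≢0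

  ∑-filter : (xs : List A) {P : A → Set} (P? : ∀ a → Dec (P a)) (f : A → ℕ) →
             ∑ₗ (filter P? xs) f ≡ ∑[ a ← xs ] (𝟙 (P? a) * f a)
  ∑-filter []       P? f = refl
  ∑-filter (x ∷ xs) P? f with P? x
  ... | yes _ = cong₂ _+_ (sym (+-identityʳ (f x))) (∑-filter xs P? f)
  ... | no  _ = ∑-filter xs P? f

  length≡∑1 : (xs : List A) → length xs ≡ ∑[ _ ← xs ] 1
  length≡∑1 []       = refl
  length≡∑1 (x ∷ xs) = cong suc (length≡∑1 xs)

module _ {A B : Set} where

  ∑-map : (xs : List A) (g : A → B) (f : B → ℕ) → ∑ₗ (map g xs) f ≡ ∑ₗ xs (f ∘ g)
  ∑-map []       g f = refl
  ∑-map (x ∷ xs) g f = cong (f (g x) +_) (∑-map xs g f)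

  ∑-concatMap : (xs : List A) (g : A → List B) (f : B → ℕ) →
                ∑ₗ (concatMap g xs) f ≡ ∑[ a ← xs ] ∑ₗ (g a) f
  ∑-concatMap []       g f = refl
  ∑-concatMap (x ∷ xs) g f = trans (∑-++ (g x) (concatMap g xs) f) (cong (∑ₗ (g x) f +_) (∑-concatMap xs g f))

  ∑-comm : (xs : List A) (ys : List B) (f : A → B → ℕ) →
           ∑[ a ← xs ] ∑[ b ← ys ] f a b ≡ ∑[ b ← ys ] ∑[ a ← xs ] f a b
  ∑-comm []       ys f = sym (∑-zero ys (λ _ → refl))
  ∑-comm (x ∷ xs) ys f =
    trans (cong (∑ₗ ys (f x) +_) (∑-comm xs ys f)) (sym (∑-distrib-+ ys (f x) (λ b → ∑[ a ← xs ] f a b)))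

record Finite (A : Set) : Set where
  field
    elements      : List A
    decEq         : DecidableEquality A
    elements-once : ∀ a → ∑[ b ← elements ] 𝟙 (decEq b a) ≡ 1
open Finite public

∑ᶠ : Finite A → (A → ℕ) → ℕ
∑ᶠ F = ∑ₗ (elements F)

syntax ∑ᶠ F (λ a → e) = ∑[ a ∈ F ] e

module _ (F : Finite A) where

  ∑-sift : (a₀ : A) (f : A → ℕ) → ∑[ a ∈ F ] (𝟙 (decEq F a a₀) * f a) ≡ f a₀
  ∑-sift a₀ f = begin
    ∑[ a ∈ F ] (𝟙 (decEq F a a₀) * f a)  ≡⟨ ∑-cong (elements F) sifted ⟩
    ∑[ a ∈ F ] (f a₀ * 𝟙 (decEq F a a₀)) ≡⟨ ∑-*ˡ (elements F) (f a₀) _ ⟩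
    f a₀ * ∑[ a ∈ F ] 𝟙 (decEq F a a₀)    ≡⟨ cong (f a₀ *_) (elements-once F a₀) ⟩
    f a₀ * 1                              ≡⟨ *-identityʳ (f a₀) ⟩
    f a₀                                  ∎
    where
    open ≡-Reasoning
    sifted : ∀ a → 𝟙 (decEq F a a₀) * f a ≡ f a₀ * 𝟙 (decEq F a a₀)
    sifted a with decEq F a a₀
    ... | yes refl = *-comm 1 (f a)
    ... | no  _    = sym (*-zeroʳ (f a₀))

  term≤∑ : (a₀ : A) (f : A → ℕ) → f a₀ ≤ ∑ᶠ F f
  term≤∑ a₀ f = subst (_≤ ∑ᶠ F f) (∑-sift a₀ f) (∑-mono (elements F) 𝟙*≤)
    where
    𝟙*≤ : ∀ a → 𝟙 (decEq F a a₀) * f a ≤ f a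
    𝟙*≤ a with decEq F a a₀
    ... | yes _ = ≤-reflexive (+-identityʳ (f a))
    ... | no  _ = z≤n

  ∑-update : (a₀ : A) (f g : A → ℕ) (e : ℕ) →
             (∀ a → a ≢ a₀ → f a ≡ g a) → f a₀ ≡ g a₀ + e → ∑ᶠ F f ≡ ∑ᶠ F g + e
  ∑-update a₀ f g e same changed = begin
    ∑ᶠ F f                                          ≡⟨ ∑-cong (elements F) split ⟩
    ∑[ a ∈ F ] (g a + 𝟙 (decEq F a a₀) * e)         ≡⟨ ∑-distrib-+ (elements F) g _ ⟩
    ∑ᶠ F g + ∑[ a ∈ F ] (𝟙 (decEq F a a₀) * e)      ≡⟨ cong (∑ᶠ F g +_) (∑-sift a₀ (λ _ → e)) ⟩
    ∑ᶠ F g + e                                      ∎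
    where
    open ≡-Reasoning
    split : ∀ a → f a ≡ g a + 𝟙 (decEq F a a₀) * e
    split a with decEq F a a₀
    ... | yes refl = trans changed (cong (g a +_) (sym (+-identityʳ e)))
    ... | no  a≢a₀ = trans (same a a≢a₀) (sym (+-identityʳ (g a)))

  ∈-elements : ∀ a → a ∈ₗ elements F
  ∈-elements a with ∑≢0⇒∃ (elements F) _ (λ e → 1≢0 (trans (sym (elements-once F a)) e))
    where 1≢0 : 1 ≢ 0
          1≢0 ()
  ... | b , b∈ , ne = subst (_∈ₗ elements F) (𝟙≢0⇒ (decEq F b a) ne) b∈

  all? : {P : A → Set} → (∀ a → Dec (P a)) → Dec (∀ a → P a)
  all? P? = map′ (λ ps a → ListAll.lookup ps (∈-elements a)) (λ p → ListAll.tabulate (λ {a} _ → p a))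
                 (ListAll.all? P? (elements F))

∑-reindex : (FA : Finite A) (FB : Finite B) {Q : B → Set} (Q? : ∀ b → Dec (Q b))
            (from : B → A) (to : A → B) →
            (∀ a → Q (to a)) → (∀ a → from (to a) ≡ a) → (∀ b → Q b → to (from b) ≡ b) →
            (f : A → ℕ) → ∑ᶠ FA f ≡ ∑[ b ∈ FB ] (𝟙 (Q? b) * f (from b))
∑-reindex FA FB Q? from to Q-to from∘to to∘from f = sym (begin
  ∑[ b ∈ FB ] (𝟙 (Q? b) * f (from b))
    ≡⟨ ∑-cong (elements FB) (λ b → cong (𝟙 (Q? b) *_) (sym (∑-sift FA (from b) f))) ⟩
  ∑[ b ∈ FB ] (𝟙 (Q? b) * ∑[ a ∈ FA ] (𝟙 (decEq FA a (from b)) * f a))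
    ≡⟨ ∑-cong (elements FB) (λ b → sym (∑-*ˡ (elements FA) (𝟙 (Q? b)) _)) ⟩
  ∑[ b ∈ FB ] ∑[ a ∈ FA ] (𝟙 (Q? b) * (𝟙 (decEq FA a (from b)) * f a))
    ≡⟨ ∑-comm (elements FB) (elements FA) _ ⟩
  ∑[ a ∈ FA ] ∑[ b ∈ FB ] (𝟙 (Q? b) * (𝟙 (decEq FA a (from b)) * f a))
    ≡⟨ ∑-cong (elements FA) (λ a → ∑-cong (elements FB) (same-pairs a)) ⟩
  ∑[ a ∈ FA ] ∑[ b ∈ FB ] (𝟙 (decEq FB b (to a)) * f a)
    ≡⟨ ∑-cong (elements FA) (λ a → ∑-*ʳ (elements FB) (f a) _) ⟩
  ∑[ a ∈ FA ] (∑[ b ∈ FB ] 𝟙 (decEq FB b (to a)) * f a)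
    ≡⟨ ∑-cong (elements FA) (λ a → cong (_* f a) (elements-once FB (to a))) ⟩
  ∑[ a ∈ FA ] (1 * f a)
    ≡⟨ ∑-cong (elements FA) (λ a → *-identityˡ (f a)) ⟩
  ∑ᶠ FA f ∎)
  where
  open ≡-Reasoning
  same-pairs : ∀ a b → 𝟙 (Q? b) * (𝟙 (decEq FA a (from b)) * f a) ≡ 𝟙 (decEq FB b (to a)) * f a
  same-pairs a b = begin
    𝟙 (Q? b) * (𝟙 (decEq FA a (from b)) * f a)  ≡⟨ *-assoc (𝟙 (Q? b)) _ (f a) ⟨
    𝟙 (Q? b) * 𝟙 (decEq FA a (from b)) * f a    ≡⟨ cong (_* f a) (𝟙-× (Q? b) (decEq FA a (from b))) ⟨
    𝟙 (Q? b ×-dec decEq FA a (from b)) * f a    ≡⟨ cong (_* f a) (𝟙-cong (Q? b ×-dec decEq FA a (from b)) (decEq FB b (to a))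
                                                     (λ { (qb , refl) → sym (to∘from b qb) })
                                                     (λ { refl → Q-to a , sym (from∘to a) })) ⟩
    𝟙 (decEq FB b (to a)) * f a                 ∎

module _ (FA : Finite A) (FB : Finite B) {C : Set} (_≟_ : DecidableEquality C) (h : A → B → C)
         (h-injective : ∀ {a b a′ b′} → h a b ≡ h a′ b′ → a ≡ a′ × b ≡ b′) where

  images : List C
  images = concatMap (λ a → map (h a) (elements FB)) (elements FA)

  ∑-images : (f : C → ℕ) → ∑ₗ images f ≡ ∑[ a ∈ FA ] ∑[ b ∈ FB ] f (h a b)
  ∑-images f = trans (∑-concatMap (elements FA) _ f) (∑-cong (elements FA) (λ a → ∑-map (elements FB) (h a) f))

  images-once : ∀ a₀ b₀ → ∑[ c ← images ] 𝟙 (c ≟ h a₀ b₀) ≡ 1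
  images-once a₀ b₀ = begin
    ∑[ c ← images ] 𝟙 (c ≟ h a₀ b₀)
      ≡⟨ ∑-images _ ⟩
    ∑[ a ∈ FA ] ∑[ b ∈ FB ] 𝟙 (h a b ≟ h a₀ b₀)
      ≡⟨ ∑-cong (elements FA) (λ a → ∑-cong (elements FB) (λ b →
           trans (𝟙-cong (h a b ≟ h a₀ b₀) (decEq FA a a₀ ×-dec decEq FB b b₀) h-injective
                         (λ { (refl , refl) → refl }))
                 (𝟙-× (decEq FA a a₀) (decEq FB b b₀)))) ⟩
    ∑[ a ∈ FA ] ∑[ b ∈ FB ] (𝟙 (decEq FA a a₀) * 𝟙 (decEq FB b b₀))
      ≡⟨ ∑-cong (elements FA) (λ a → ∑-*ˡ (elements FB) (𝟙 (decEq FA a a₀)) _) ⟩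
    ∑[ a ∈ FA ] (𝟙 (decEq FA a a₀) * ∑[ b ∈ FB ] 𝟙 (decEq FB b b₀))
      ≡⟨ ∑-sift FA a₀ _ ⟩
    ∑[ b ∈ FB ] 𝟙 (decEq FB b b₀)
      ≡⟨ elements-once FB b₀ ⟩
    1 ∎
    where open ≡-Reasoning

allFin-once : (m : ℕ) (j : Fin m) → ∑[ i ← allFin m ] 𝟙 (i Finₚ.≟ j) ≡ 1
allFin-once (suc m) j = trans (cong (λ is → ∑[ i ← zero ∷ is ] 𝟙 (i Finₚ.≟ j)) (sym (Listₚ.map-tabulate id suc)))
                              (trans (cong (𝟙 (zero Finₚ.≟ j) +_) (∑-map (allFin m) suc _)) (split j))
  where
  split : (j : Fin (suc m)) → 𝟙 (zero Finₚ.≟ j) + ∑[ i ← allFin m ] 𝟙 (suc i Finₚ.≟ j) ≡ 1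
  split zero    = cong suc (∑-zero (allFin m) (λ _ → refl))
  split (suc j) = trans (∑-cong (allFin m) (λ i → 𝟙-cong (suc i Finₚ.≟ suc j) (i Finₚ.≟ j) Finₚ.suc-injective (cong suc)))
                        (allFin-once m j)

finite-Fin : (m : ℕ) → Finite (Fin m)
finite-Fin m = record { elements = allFin m ; decEq = Finₚ._≟_ ; elements-once = allFin-once m }

finite-Bool : Finite Bool
finite-Bool = record { elements = false ∷ true ∷ [] ; decEq = Boolₚ._≟_ ; elements-once = λ { false → refl ; true → refl } }

finite-× : {A B : Set} → Finite A → Finite B → Finite (A × B)
finite-× {A} {B} FA FB = record
  { elements      = images FA FB _≟_ _,_ ,-injective
  ; decEq         = _≟_
  ; elements-once = λ { (a , b) → images-once FA FB _≟_ _,_ ,-injective a b } }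
  where
  _≟_ : DecidableEquality (A × B)
  _≟_ = ≡-dec (decEq FA) (decEq FB)

∑-× : (FA : Finite A) (FB : Finite B) (f : A × B → ℕ) →
      ∑[ p ∈ finite-× FA FB ] f p ≡ ∑[ a ∈ FA ] ∑[ b ∈ FB ] f (a , b)
∑-× FA FB = ∑-images FA FB (decEq (finite-× FA FB)) _,_ ,-injective

finite-Vec : {A : Set} → Finite A → (d : ℕ) → Finite (Vec A d)
finite-Vec FA zero    = record { elements = [] ∷ [] ; decEq = Vecₚ.≡-dec (decEq FA) ; elements-once = λ { [] → refl } }
finite-Vec {A} FA (suc d) = record
  { elements      = images FA (finite-Vec FA d) _≟_ _∷_ Vecₚ.∷-injective
  ; decEq         = _≟_
  ; elements-once = λ { (a ∷ v) → images-once FA (finite-Vec FA d) _≟_ _∷_ Vecₚ.∷-injective a v } }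
  where
  _≟_ : DecidableEquality (Vec A (suc d))
  _≟_ = Vecₚ.≡-dec (decEq FA)

∑-∷ : (FA : Finite A) (d : ℕ) (f : Vec A (suc d) → ℕ) →
      ∑[ v ∈ finite-Vec FA (suc d) ] f v ≡ ∑[ a ∈ FA ] ∑[ v ∈ finite-Vec FA d ] f (a ∷ v)
∑-∷ FA d = ∑-images FA (finite-Vec FA d) (decEq (finite-Vec FA (suc d))) _∷_ Vecₚ.∷-injective

sumVec≡∑ : {m : ℕ} (d : ℕ) (f : Vec (Fin m) d → ℕ) → sumVec d f ≡ ∑[ v ∈ finite-Vec (finite-Fin m) d ] f v
sumVec≡∑ zero    f = sym (+-identityʳ _)
sumVec≡∑ {m} (suc d) f = trans (∑-cong (allFin m) (λ a → sumVec≡∑ d (λ v → f (a ∷ v))))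
                               (sym (∑-∷ (finite-Fin m) d f))

finite-Tab : (k m : ℕ) → Finite (Tab k m)
finite-Tab k zero    = finite-Bool
finite-Tab k (suc m) = finite-Vec (finite-Tab k m) k

module _ {P : ℕ → Set} where

  infixl 9 _‼_

  _‼_ : {d : ℕ} {rs : Vec ℕ d} → All P rs → (i : Fin d) → P (lookup rs i)
  (p ∷ ps) ‼ zero  = p
  (p ∷ ps) ‼ suc i = ps ‼ i

  tabulateᴬ : {d : ℕ} {rs : Vec ℕ d} → ((i : Fin d) → P (lookup rs i)) → All P rs
  tabulateᴬ {rs = []}     f = []
  tabulateᴬ {rs = r ∷ rs} f = f zero ∷ tabulateᴬ (f ∘ suc)

  ‼-tabulateᴬ : {d : ℕ} {rs : Vec ℕ d} (f : (i : Fin d) → P (lookup rs i)) (i : Fin d) →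
                tabulateᴬ {rs = rs} f ‼ i ≡ f i
  ‼-tabulateᴬ {rs = r ∷ rs} f zero    = refl
  ‼-tabulateᴬ {rs = r ∷ rs} f (suc i) = ‼-tabulateᴬ {rs = rs} (f ∘ suc) i

  ‼-ext : {d : ℕ} {rs : Vec ℕ d} {a a′ : All P rs} → (∀ i → a ‼ i ≡ a′ ‼ i) → a ≡ a′
  ‼-ext {a = []}     {[]}     eq = refl
  ‼-ext {a = p ∷ ps} {q ∷ qs} eq = cong₂ _∷_ (eq zero) (‼-ext (eq ∘ suc))

  ≡-decᴬ : (∀ r → DecidableEquality (P r)) → {d : ℕ} (rs : Vec ℕ d) → DecidableEquality (All P rs)
  ≡-decᴬ dec []       []       []       = yes refl
  ≡-decᴬ dec (r ∷ rs) (p ∷ ps) (q ∷ qs) =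
    map′ (λ { (refl , refl) → refl }) (λ { refl → refl , refl }) (dec r p q ×-dec ≡-decᴬ dec rs ps qs)

  finite-All : (∀ r → Finite (P r)) → {d : ℕ} (rs : Vec ℕ d) → Finite (All P rs)
  finite-All F [] = record { elements = [] ∷ [] ; decEq = ≡-decᴬ (decEq ∘ F) [] ; elements-once = λ { [] → refl } }
  finite-All F (r ∷ rs) = record
    { elements      = images (F r) (finite-All F rs) _≟_ _∷_ ∷-injective
    ; decEq         = _≟_
    ; elements-once = λ { (p ∷ ps) → images-once (F r) (finite-All F rs) _≟_ _∷_ ∷-injective p ps } }
    where
    _≟_ : DecidableEquality (All P (r ∷ rs))
    _≟_ = ≡-decᴬ (decEq ∘ F) (r ∷ rs)
    ∷-injective : ∀ {p q ps qs} → _≡_ {A = All P (r ∷ rs)} (p ∷ ps) (q ∷ qs) → p ≡ q × ps ≡ qs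
    ∷-injective refl = refl , refl

  ∑-All∷ : (F : ∀ r → Finite (P r)) {d : ℕ} (r : ℕ) (rs : Vec ℕ d) (f : All P (r ∷ rs) → ℕ) →
           ∑[ a ∈ finite-All F (r ∷ rs) ] f a ≡ ∑[ p ∈ F r ] ∑[ ps ∈ finite-All F rs ] f (p ∷ ps)
  ∑-All∷ F r rs = ∑-images (F r) (finite-All F rs) (decEq (finite-All F (r ∷ rs))) _∷_ λ { refl → refl , refl }

  updateᴬ : {d : ℕ} {rs : Vec ℕ d} → All P rs → (i : Fin d) → P (lookup rs i) → All P rs
  updateᴬ (p ∷ ps) zero    z = z ∷ ps
  updateᴬ (p ∷ ps) (suc i) z = p ∷ updateᴬ ps i z

  ‼-updateᴬ : {d : ℕ} {rs : Vec ℕ d} (a : All P rs) (i : Fin d) (z : P (lookup rs i)) → updateᴬ a i z ‼ i ≡ z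
  ‼-updateᴬ (p ∷ ps) zero    z = refl
  ‼-updateᴬ (p ∷ ps) (suc i) z = ‼-updateᴬ ps i z

  ‼-updateᴬ′ : {d : ℕ} {rs : Vec ℕ d} (a : All P rs) {i j : Fin d} (z : P (lookup rs i)) → i ≢ j → updateᴬ a i z ‼ j ≡ a ‼ j
  ‼-updateᴬ′ (p ∷ ps) {zero}  {zero}  z i≢j = ⊥-elim (i≢j refl)
  ‼-updateᴬ′ (p ∷ ps) {zero}  {suc j} z i≢j = refl
  ‼-updateᴬ′ (p ∷ ps) {suc i} {zero}  z i≢j = refl
  ‼-updateᴬ′ (p ∷ ps) {suc i} {suc j} z i≢j = ‼-updateᴬ′ ps z (i≢j ∘ cong suc)

  updateᴬ-id : {d : ℕ} {rs : Vec ℕ d} (a : All P rs) (i : Fin d) → updateᴬ a i (a ‼ i) ≡ a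
  updateᴬ-id (p ∷ ps) zero    = refl
  updateᴬ-id (p ∷ ps) (suc i) = cong (p ∷_) (updateᴬ-id ps i)

  updateᴬ-idem : {d : ℕ} {rs : Vec ℕ d} (a : All P rs) (i : Fin d) (z z′ : P (lookup rs i)) →
                 updateᴬ (updateᴬ a i z) i z′ ≡ updateᴬ a i z′
  updateᴬ-idem (p ∷ ps) zero    z z′ = refl
  updateᴬ-idem (p ∷ ps) (suc i) z z′ = cong (p ∷_) (updateᴬ-idem ps i z z′)

  updateᴬ-comm : {d : ℕ} {rs : Vec ℕ d} (a : All P rs) {i j : Fin d} (z : P (lookup rs i)) (z′ : P (lookup rs j)) → i ≢ j →
                 updateᴬ (updateᴬ a i z) j z′ ≡ updateᴬ (updateᴬ a j z′) i z
  updateᴬ-comm (p ∷ ps) {zero}  {zero}  z z′ i≢j = ⊥-elim (i≢j refl)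
  updateᴬ-comm (p ∷ ps) {zero}  {suc j} z z′ i≢j = refl
  updateᴬ-comm (p ∷ ps) {suc i} {zero}  z z′ i≢j = refl
  updateᴬ-comm (p ∷ ps) {suc i} {suc j} z z′ i≢j = cong (p ∷_) (updateᴬ-comm ps z z′ (i≢j ∘ cong suc))

  updateᴬ-induction : {d : ℕ} {rs : Vec ℕ d} (Q : All P rs → Set) →
                      (∀ a i z → Q a → Q (updateᴬ a i z)) → ∀ a b → Q a → Q b
  updateᴬ-induction {rs = []}     Q step []       []       q = q
  updateᴬ-induction {rs = r ∷ rs} Q step (p ∷ ps) (q ∷ qs) Qa =
    updateᴬ-induction (λ cs → Q (q ∷ cs)) (λ cs i z → step (q ∷ cs) (suc i) z) ps qs (step (p ∷ ps) zero q Qa)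

Vec-ext : {d : ℕ} {u v : Vec A d} → (∀ i → lookup u i ≡ lookup v i) → u ≡ v
Vec-ext {u = u} {v} eq = trans (sym (Vecₚ.tabulate∘lookup u)) (trans (Vecₚ.tabulate-cong eq) (Vecₚ.tabulate∘lookup v))

lookup-fromList : (xs : List A) (i : Fin (length xs)) → lookup (Vec.fromList xs) i ≡ List.lookup xs i
lookup-fromList (x ∷ xs) zero    = refl
lookup-fromList (x ∷ xs) (suc i) = lookup-fromList xs i

does≡true⇒ : (P? : Dec P) → does P? ≡ true → P
does≡true⇒ (yes p) _ = p

does≡false⇒ : (P? : Dec P) → does P? ≡ false → ¬ P
does≡false⇒ (no ¬p) _ = ¬p

infix 4 _∈ᵥ_ _∈ᵥ?_

_∈ᵥ_ : {d : ℕ} → A → Vec A d → Set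
_∈ᵥ_ {d = d} a x = Σ (Fin d) λ i → lookup x i ≡ a

_∈ᵥ?_ : {m d : ℕ} (w : Fin m) (x : Vec (Fin m) d) → Dec (w ∈ᵥ x)
w ∈ᵥ? x = Finₚ.any? (λ i → lookup x i Finₚ.≟ w)

image : {m d : ℕ} → Vec (Fin m) d → Fin m → Bool
image x w = does (w ∈ᵥ? x)

image-∈ : {m d : ℕ} {w : Fin m} (x : Vec (Fin m) d) → w ∈ᵥ x → image x w ≡ true
image-∈ {w = w} x = dec-true (w ∈ᵥ? x)

image-∉ : {m d : ℕ} {w : Fin m} (x : Vec (Fin m) d) → ¬ w ∈ᵥ x → image x w ≡ false
image-∉ {w = w} x = dec-false (w ∈ᵥ? x)

image⇒∈ : {m d : ℕ} {w : Fin m} (x : Vec (Fin m) d) → image x w ≡ true → w ∈ᵥ x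
image⇒∈ {w = w} x = does≡true⇒ (w ∈ᵥ? x)

image⇒∉ : {m d : ℕ} {w : Fin m} (x : Vec (Fin m) d) → image x w ≡ false → ¬ w ∈ᵥ x
image⇒∉ {w = w} x = does≡false⇒ (w ∈ᵥ? x)

image-∷-≢ : {m d : ℕ} {w a : Fin m} (x : Vec (Fin m) d) → w ≢ a → image (a ∷ x) w ≡ image x w
image-∷-≢ {w = w} {a} x w≢a = does-⇔ (mk⇔ there⁻ (λ { (i , e) → suc i , e })) (w ∈ᵥ? (a ∷ x)) (w ∈ᵥ? x)
  where
  there⁻ : w ∈ᵥ a ∷ x → w ∈ᵥ x
  there⁻ (zero  , a≡w) = ⊥-elim (w≢a (sym a≡w))
  there⁻ (suc i , e)   = i , e

image-∷-here : {m d : ℕ} (a : Fin m) (x : Vec (Fin m) d) → image (a ∷ x) a ≡ true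
image-∷-here a x = image-∈ (a ∷ x) (zero , refl)

Distinct-∷⁻ : {d : ℕ} {a : A} {x : Vec A d} → Distinct (a ∷ x) → ¬ a ∈ᵥ x × Distinct x
Distinct-∷⁻ dst = (λ { (i , e) → Finₚ.0≢1+n (sym (dst (suc i) zero e)) }) , (λ i j e → Finₚ.suc-injective (dst (suc i) (suc j) e))

Distinct-∷⁺ : {d : ℕ} {a : A} {x : Vec A d} → ¬ a ∈ᵥ x → Distinct x → Distinct (a ∷ x)
Distinct-∷⁺ a∉x dx zero    zero    e = refl
Distinct-∷⁺ a∉x dx zero    (suc j) e = ⊥-elim (a∉x (j , sym e))
Distinct-∷⁺ a∉x dx (suc i) zero    e = ⊥-elim (a∉x (i , e))
Distinct-∷⁺ a∉x dx (suc i) (suc j) e = cong suc (dx i j e)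

module _ {A : Set} (_≟_ : DecidableEquality A) where

  count : List A → A → ℕ
  count xs a = ∑[ b ← xs ] 𝟙 (b ≟ a)

  count-lookup : (xs : List A) (p : Fin (length xs)) → 1 ≤ count xs (List.lookup xs p)
  count-lookup (x ∷ xs) zero    rewrite 𝟙-yes (x ≟ x) refl = s≤s z≤n
  count-lookup (x ∷ xs) (suc p) = ≤-trans (count-lookup xs p) (m≤n+m _ _)

  count⇒lookup : (xs : List A) (a : A) → 1 ≤ count xs a → Σ (Fin (length xs)) λ p → List.lookup xs p ≡ a
  count⇒lookup (x ∷ xs) a le with x ≟ a
  ... | yes x≡a = zero , x≡a
  ... | no  _   = let p , e = count⇒lookup xs a le in suc p , e

  lookup-injective : (xs : List A) → (∀ a → count xs a ≤ 1) →
                     ∀ p q → List.lookup xs p ≡ List.lookup xs q → p ≡ q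
  lookup-injective (x ∷ xs) once zero    zero    e = refl
  lookup-injective (x ∷ xs) once zero    (suc q) e = ⊥-elim (ℕₚ.1+n≰n (≤-trans twice (once x)))
    where
    twice : 2 ≤ count (x ∷ xs) x
    twice rewrite 𝟙-yes (x ≟ x) refl = s≤s (subst (λ a → 1 ≤ count xs a) (sym e) (count-lookup xs q))
  lookup-injective (x ∷ xs) once (suc p) zero    e = sym (lookup-injective (x ∷ xs) once zero (suc p) (sym e))
  lookup-injective (x ∷ xs) once (suc p) (suc q) e =
    cong suc (lookup-injective xs (λ a → ≤-trans (m≤n+m _ _) (once a)) p q e)

  module _ {P : A → Set} (P? : ∀ a → Dec (P a)) where

    count-filter≤ : (xs : List A) (a : A) → count (filter P? xs) a ≤ count xs a
    count-filter≤ xs a = subst (_≤ count xs a) (sym (∑-filter xs P? _)) (∑-mono xs 𝟙*≤)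
      where
      𝟙*≤ : ∀ b → 𝟙 (P? b) * 𝟙 (b ≟ a) ≤ 𝟙 (b ≟ a)
      𝟙*≤ b with P? b
      ... | yes _ = ≤-reflexive (+-identityʳ _)
      ... | no  _ = z≤n

    count-filter-∈ : (xs : List A) (a : A) → P a → count (filter P? xs) a ≡ count xs a
    count-filter-∈ xs a pa = trans (∑-filter xs P? _) (∑-cong xs kept)
      where
      kept : ∀ b → 𝟙 (P? b) * 𝟙 (b ≟ a) ≡ 𝟙 (b ≟ a)
      kept b with b ≟ a
      ... | yes refl rewrite 𝟙-yes (P? b) pa = refl
      ... | no  _    = *-zeroʳ (𝟙 (P? b))

    count-filter-∉ : (xs : List A) (a : A) → ¬ P a → count (filter P? xs) a ≡ 0
    count-filter-∉ xs a ¬pa = trans (∑-filter xs P? _) (∑-zero xs dropped)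
      where
      dropped : ∀ b → 𝟙 (P? b) * 𝟙 (b ≟ a) ≡ 0
      dropped b with b ≟ a
      ... | yes refl rewrite 𝟙-no (P? b) ¬pa = refl
      ... | no  _    = *-zeroʳ (𝟙 (P? b))

  without : A → List A → List A
  without r = filter (λ s → ¬? (r ≟ s))

  product-without : (f : A → ℕ) (r : A) (ss : List A) →
                    product (map f ss) ≡ f r ^ count ss r * product (map f (without r ss))
  product-without f r []       = refl
  product-without f r (s ∷ ss) with r ≟ s
  ... | yes refl rewrite 𝟙-yes (s ≟ s) refl =
    trans (cong (f s *_) (product-without f s ss)) (sym (*-assoc (f s) _ _))
  ... | no  r≢s rewrite 𝟙-no (s ≟ r) (r≢s ∘ sym) =
    trans (cong (f s *_) (product-without f r ss)) (*-left-comm (f s) (f r ^ count ss r) _)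

  product-without-cong : {f g : A → ℕ} (r : A) (ss : List A) → (∀ s → r ≢ s → f s ≡ g s) →
                         product (map f (without r ss)) ≡ product (map g (without r ss))
  product-without-cong r []       eq = refl
  product-without-cong r (s ∷ ss) eq with r ≟ s
  ... | yes _   = product-without-cong r ss eq
  ... | no  r≢s = cong₂ _*_ (eq s r≢s) (product-without-cong r ss eq)

  count-deduplicate≤1 : (ss : List A) (r : A) → count (List.deduplicate _≟_ ss) r ≤ 1
  count-deduplicate≤1 []       r = z≤n
  count-deduplicate≤1 (s ∷ ss) r with s ≟ r
  ... | yes refl = s≤s (≤-reflexive (count-filter-∉ _ (List.deduplicate _≟_ ss) s (λ s≢s → s≢s refl)))
  ... | no  _    = ≤-trans (count-filter≤ _ (List.deduplicate _≟_ ss) r) (count-deduplicate≤1 ss r)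

  count-deduplicate≥1 : (ss : List A) (r : A) → 1 ≤ count ss r → 1 ≤ count (List.deduplicate _≟_ ss) r
  count-deduplicate≥1 (s ∷ ss) r le with s ≟ r
  ... | yes refl = s≤s z≤n
  ... | no  s≢r  = subst (1 ≤_) (sym (count-filter-∈ _ (List.deduplicate _≟_ ss) r s≢r))
                         (count-deduplicate≥1 ss r le)

multiplicity-∷ : {d : ℕ} (r : ℕ) (rs : Vec ℕ d) (s : ℕ) → multiplicity (r ∷ rs) s ≡ 𝟙 (s ℕₚ.≟ r) + multiplicity rs s
multiplicity-∷ r rs s with s ≡ᵇ r
... | true  = refl
... | false = refl

multiplicity≡count : {d : ℕ} (rs : Vec ℕ d) (s : ℕ) → multiplicity rs s ≡ count ℕₚ._≟_ (Vec.toList rs) s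
multiplicity≡count []       s = refl
multiplicity≡count (r ∷ rs) s =
  trans (multiplicity-∷ r rs s) (cong₂ _+_ (𝟙-cong (s ℕₚ.≟ r) (r ℕₚ.≟ s) sym sym) (multiplicity≡count rs s))

∏r! : {d : ℕ} → Vec ℕ d → ℕ
∏r! rs = product (map _! (Vec.toList rs))

∏m! : {d : ℕ} → Vec ℕ d → ℕ
∏m! rs = product (map (λ s → multiplicity rs s !) (List.deduplicate ℕₚ._≟_ (Vec.toList rs)))

∏m!-∷ : {d : ℕ} (r : ℕ) (rs : Vec ℕ d) → ∏m! (r ∷ rs) ≡ multiplicity (r ∷ rs) r * ∏m! rs
∏m!-∷ r rs = begin
  ∏m! (r ∷ rs)                   ≡⟨⟩
  multiplicity (r ∷ rs) r ! * product (map (λ s → multiplicity (r ∷ rs) s !) (without ℕₚ._≟_ r ds))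
    ≡⟨ cong₂ _*_ (cong _! 1+m) (product-without-cong ℕₚ._≟_ r ds (λ s r≢s → cong _! (other s r≢s))) ⟩
  suc m ! * rest                 ≡⟨ *-assoc (suc m) (m !) rest ⟩
  suc m * (m ! * rest)           ≡⟨ cong₂ _*_ (sym 1+m) (sym ∏m!-rs) ⟩
  multiplicity (r ∷ rs) r * ∏m! rs ∎
  where
  open ≡-Reasoning
  ds : List ℕ
  ds = List.deduplicate ℕₚ._≟_ (Vec.toList rs)
  m rest : ℕ
  m    = multiplicity rs r
  rest = product (map (λ s → multiplicity rs s !) (without ℕₚ._≟_ r ds))
  1+m : multiplicity (r ∷ rs) r ≡ suc m
  1+m = trans (multiplicity-∷ r rs r) (cong (_+ m) (𝟙-yes (r ℕₚ.≟ r) refl))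
  other : ∀ s → r ≢ s → multiplicity (r ∷ rs) s ≡ multiplicity rs s
  other s r≢s = trans (multiplicity-∷ r rs s) (cong (_+ _) (𝟙-no (s ℕₚ.≟ r) (r≢s ∘ sym)))
  absent : count ℕₚ._≟_ ds r ≡ 0 → m ≡ 0
  absent eq with m in m-eq
  ... | zero  = refl
  ... | suc _ = ⊥-elim (ℕₚ.n≮0 (subst (1 ≤_) eq (count-deduplicate≥1 ℕₚ._≟_ (Vec.toList rs) r
                  (subst (1 ≤_) (trans (sym m-eq) (multiplicity≡count rs r)) (s≤s z≤n)))))
  -- If r does not survive deduplication it does not occur in rs at all, and then m ! = 0 ! = 1.
  m!^count≡m! : (m !) ^ count ℕₚ._≟_ ds r ≡ m !
  m!^count≡m! with count ℕₚ._≟_ ds r in eq | count-deduplicate≤1 ℕₚ._≟_ (Vec.toList rs) r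
  ... | 0           | _       = cong _! (sym (absent eq))
  ... | 1           | _       = *-identityʳ (m !)
  ... | suc (suc _) | s≤s ()
  ∏m!-rs : ∏m! rs ≡ m ! * rest
  ∏m!-rs = trans (product-without ℕₚ._≟_ (λ s → multiplicity rs s !) r ds) (cong (_* rest) m!^count≡m!)

infix 4 _≐_ _≐?_

_≐_ : {m d : ℕ} → Vec (Fin m) d → (Fin m → Bool) → Set
x ≐ W = ∀ w → image x w ≡ W w

_≐?_ : {m d : ℕ} (x : Vec (Fin m) d) (W : Fin m → Bool) → Dec (x ≐ W)
x ≐? W = Finₚ.all? (λ w → image x w Boolₚ.≟ W w)

module Arrangements {m : ℕ} (ρ : Fin m → ℕ) where

  Vecs : (d : ℕ) → Finite (Vec (Fin m) d)
  Vecs = finite-Vec (finite-Fin m)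

  IsArrangement : {d : ℕ} → (Fin m → Bool) → Vec ℕ d → Vec (Fin m) d → Set
  IsArrangement W rs x = Distinct x × x ≐ W × (∀ i → ρ (lookup x i) ≡ lookup rs i)

  isArrangement? : {d : ℕ} (W : Fin m → Bool) (rs : Vec ℕ d) (x : Vec (Fin m) d) → Dec (IsArrangement W rs x)
  isArrangement? W rs x = distinct? x ×-dec (x ≐? W ×-dec Finₚ.all? (λ i → ρ (lookup x i) ℕₚ.≟ lookup rs i))

  arrangements : {d : ℕ} → (Fin m → Bool) → Vec ℕ d → ℕ
  arrangements {d} W rs = ∑[ x ∈ Vecs d ] 𝟙 (isArrangement? W rs x)

  fibreSize : (Fin m → Bool) → ℕ → ℕ
  fibreSize W s = ∑[ w ∈ finite-Fin m ] 𝟙 ((W w Boolₚ.≟ true) ×-dec (ρ w ℕₚ.≟ s))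

  Balanced : {d : ℕ} → (Fin m → Bool) → Vec ℕ d → Set
  Balanced W rs = ∀ s → fibreSize W s ≡ multiplicity rs s

  remove : (Fin m → Bool) → Fin m → Fin m → Bool
  remove W a w = if does (w Finₚ.≟ a) then false else W w

  remove-≢ : (W : Fin m → Bool) {a w : Fin m} → w ≢ a → remove W a w ≡ W w
  remove-≢ W {a} {w} w≢a with w Finₚ.≟ a
  ... | yes w≡a = ⊥-elim (w≢a w≡a)
  ... | no  _   = refl

  remove-≡ : (W : Fin m → Bool) (a : Fin m) → remove W a a ≡ false
  remove-≡ W a with a Finₚ.≟ a
  ... | yes _   = refl
  ... | no  a≢a = ⊥-elim (a≢a refl)

  Admits : (Fin m → Bool) → ℕ → Fin m → Set
  Admits W r a = W a ≡ true × ρ a ≡ r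

  admits? : (W : Fin m → Bool) (r : ℕ) (a : Fin m) → Dec (Admits W r a)
  admits? W r a = (W a Boolₚ.≟ true) ×-dec (ρ a ℕₚ.≟ r)

  fibreSize-remove : (W : Fin m → Bool) (a : Fin m) (s : ℕ) → W a ≡ true →
                     fibreSize W s ≡ fibreSize (remove W a) s + 𝟙 (ρ a ℕₚ.≟ s)
  fibreSize-remove W a s Wa = ∑-update (finite-Fin m) a _ _ _
    (λ w w≢a → cong (λ β → 𝟙 ((β Boolₚ.≟ true) ×-dec (ρ w ℕₚ.≟ s))) (sym (remove-≢ W w≢a))) at-a
    where
    at-a : 𝟙 ((W a Boolₚ.≟ true) ×-dec (ρ a ℕₚ.≟ s)) ≡ 𝟙 ((remove W a a Boolₚ.≟ true) ×-dec (ρ a ℕₚ.≟ s)) + 𝟙 (ρ a ℕₚ.≟ s)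
    at-a rewrite remove-≡ W a | Wa = refl

  module _ {d : ℕ} (W : Fin m → Bool) (r : ℕ) (rs : Vec ℕ d) {a : Fin m} (adm : Admits W r a) where

    private
      ρa≟s≡s≟r : ∀ s → 𝟙 (ρ a ℕₚ.≟ s) ≡ 𝟙 (s ℕₚ.≟ r)
      ρa≟s≡s≟r s = 𝟙-cong (ρ a ℕₚ.≟ s) (s ℕₚ.≟ r) (λ e → trans (sym e) (proj₂ adm)) (λ e → trans (proj₂ adm) (sym e))

      shift : ∀ s → fibreSize W s ≡ fibreSize (remove W a) s + 𝟙 (s ℕₚ.≟ r)
      shift s = trans (fibreSize-remove W a s (proj₁ adm)) (cong (_ +_) (ρa≟s≡s≟r s))

      multiplicity-∷′ : ∀ s → multiplicity (r ∷ rs) s ≡ multiplicity rs s + 𝟙 (s ℕₚ.≟ r)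
      multiplicity-∷′ s = trans (multiplicity-∷ r rs s) (+-comm (𝟙 (s ℕₚ.≟ r)) _)

    Balanced-remove : Balanced W (r ∷ rs) → Balanced (remove W a) rs
    Balanced-remove bal s = +-cancelʳ-≡ _ _ _ (trans (sym (shift s)) (trans (bal s) (multiplicity-∷′ s)))

    Balanced-insert : Balanced (remove W a) rs → Balanced W (r ∷ rs)
    Balanced-insert bal s = trans (shift s) (trans (cong (_+ _) (bal s)) (sym (multiplicity-∷′ s)))

  module _ {d : ℕ} (W : Fin m → Bool) (r : ℕ) (rs : Vec ℕ d) (a : Fin m) (x : Vec (Fin m) d) where

    IsArrangement-∷⁻ : IsArrangement W (r ∷ rs) (a ∷ x) → Admits W r a × IsArrangement (remove W a) rs x
    IsArrangement-∷⁻ (dst , ax≐W , profile) =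
      (trans (sym (ax≐W a)) (image-∷-here a x) , profile zero) , (proj₂ (Distinct-∷⁻ dst) , x≐W-a , profile ∘ suc)
      where
      x≐W-a : x ≐ remove W a
      x≐W-a w with w Finₚ.≟ a
      ... | yes refl = image-∉ x (proj₁ (Distinct-∷⁻ dst))
      ... | no  w≢a  = trans (sym (image-∷-≢ x w≢a)) (ax≐W w)

    IsArrangement-∷⁺ : Admits W r a → IsArrangement (remove W a) rs x → IsArrangement W (r ∷ rs) (a ∷ x)
    IsArrangement-∷⁺ (Wa , ρa) (dst , x≐W-a , profile) =
      Distinct-∷⁺ (image⇒∉ x (trans (x≐W-a a) (remove-≡ W a))) dst , ax≐W , λ { zero → ρa ; (suc i) → profile i }
      where
      ax≐W : (a ∷ x) ≐ W
      ax≐W w with w Finₚ.≟ a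
      ... | yes refl = trans (image-∷-here w x) (sym Wa)
      ... | no  w≢a  = trans (image-∷-≢ x w≢a) (trans (x≐W-a w) (remove-≢ W w≢a))

  arrangements-∷ : {d : ℕ} (W : Fin m → Bool) (r : ℕ) (rs : Vec ℕ d) →
                   arrangements W (r ∷ rs) ≡ ∑[ a ∈ finite-Fin m ] (𝟙 (admits? W r a) * arrangements (remove W a) rs)
  arrangements-∷ {d} W r rs = trans (∑-∷ (finite-Fin m) d _) (∑-cong (allFin m) λ a →
    trans (∑-cong (elements (Vecs d)) (λ x →
            trans (𝟙-cong (isArrangement? W (r ∷ rs) (a ∷ x)) (admits? W r a ×-dec isArrangement? (remove W a) rs x)
                          (IsArrangement-∷⁻ W r rs a x) (λ (adm , arr) → IsArrangement-∷⁺ W r rs a x adm arr))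
                  (𝟙-× (admits? W r a) (isArrangement? (remove W a) rs x))))
          (∑-*ˡ (elements (Vecs d)) (𝟙 (admits? W r a)) _))

  Balanced-[] : (W : Fin m → Bool) → Balanced W [] → ∀ w → W w ≡ false
  Balanced-[] W bal w with W w in Ww
  ... | false = refl
  ... | true  = ⊥-elim (ℕₚ.n≮0 (subst (1 ≤_) (bal (ρ w))
                  (subst (_≤ fibreSize W (ρ w)) (𝟙-yes (admits? W (ρ w) w) (Ww , refl)) (term≤∑ (finite-Fin m) w _))))

  arrangements-balanced : {d : ℕ} (W : Fin m → Bool) (rs : Vec ℕ d) → Balanced W rs → arrangements W rs ≡ ∏m! rs
  arrangements-balanced W [] bal =
    trans (+-identityʳ _) (𝟙-yes (isArrangement? W [] [])
      ((λ ()) , (λ w → trans (image-∉ {w = w} [] (λ ())) (sym (Balanced-[] W bal w))) , (λ ())))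
  arrangements-balanced W (r ∷ rs) bal = begin
    arrangements W (r ∷ rs)                                        ≡⟨ arrangements-∷ W r rs ⟩
    ∑[ a ∈ finite-Fin m ] (𝟙 (admits? W r a) * arrangements (remove W a) rs)
      ≡⟨ ∑-cong (allFin _) (λ a → 𝟙*-cong (admits? W r a) (λ adm → arrangements-balanced (remove W a) rs (Balanced-remove W r rs adm bal))) ⟩
    ∑[ a ∈ finite-Fin m ] (𝟙 (admits? W r a) * ∏m! rs)            ≡⟨ ∑-*ʳ (allFin m) (∏m! rs) (𝟙 ∘ admits? W r) ⟩
    fibreSize W r * ∏m! rs                                         ≡⟨ cong (_* ∏m! rs) (bal r) ⟩
    multiplicity (r ∷ rs) r * ∏m! rs                               ≡⟨ ∏m!-∷ r rs ⟨
    ∏m! (r ∷ rs)                                                   ∎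
    where open ≡-Reasoning

  IsArrangement⇒Balanced : {d : ℕ} (W : Fin m → Bool) (rs : Vec ℕ d) (x : Vec (Fin m) d) → IsArrangement W rs x → Balanced W rs
  IsArrangement⇒Balanced W [] [] (_ , x≐W , _) s = ∑-zero (allFin _) λ w →
    𝟙-no (admits? W s w) (λ (Ww , _) → false≢true (trans (x≐W w) Ww))
    where false≢true : false ≢ true
          false≢true ()
  IsArrangement⇒Balanced W (r ∷ rs) (a ∷ x) arr =
    let adm , arr′ = IsArrangement-∷⁻ W r rs a x arr
    in Balanced-insert W r rs adm (IsArrangement⇒Balanced (remove W a) rs x arr′)

  arrangements≢0⇒Balanced : {d : ℕ} (W : Fin m → Bool) (rs : Vec ℕ d) → arrangements W rs ≢ 0 → Balanced W rs
  arrangements≢0⇒Balanced W rs ne =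
    let x , _ , arr≢0 = ∑≢0⇒∃ (elements (Vecs _)) _ ne
    in IsArrangement⇒Balanced W rs x (𝟙≢0⇒ (isArrangement? W rs x) arr≢0)

module _ {k : ℕ} where
  open Arrangements {k} (λ _ → 0)

  size : (Fin k → Bool) → ℕ
  size S = ∑[ a ∈ finite-Fin k ] 𝟙 (S a Boolₚ.≟ true)

  injections : (Fin k → Bool) → ℕ → ℕ
  injections S r = ∑[ v ∈ Vecs r ] 𝟙 (distinct? v ×-dec v ≐? S)

  private
    injections≡arrangements : (S : Fin k → Bool) (r : ℕ) → injections S r ≡ arrangements S (Vec.replicate r 0)
    injections≡arrangements S r = ∑-cong (elements (Vecs r)) λ v →
      𝟙-cong (distinct? v ×-dec v ≐? S) (isArrangement? S (Vec.replicate r 0) v)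
             (λ (dst , v≐S) → dst , v≐S , λ i → sym (Vecₚ.lookup-replicate i 0))
             (λ (dst , v≐S , _) → dst , v≐S)

    fibreSize≡size : (S : Fin k → Bool) (s : ℕ) → fibreSize S s ≡ 𝟙 (s ℕₚ.≟ 0) * size S
    fibreSize≡size S s = trans (∑-cong (allFin k) λ a →
                                  trans (𝟙-× (S a Boolₚ.≟ true) (0 ℕₚ.≟ s))
                                        (trans (*-comm (𝟙 (S a Boolₚ.≟ true)) _) (cong (_* _) (𝟙-cong (0 ℕₚ.≟ s) (s ℕₚ.≟ 0) sym sym))))
                               (∑-*ˡ (allFin k) (𝟙 (s ℕₚ.≟ 0)) _)

    multiplicity-replicate : (r s : ℕ) → multiplicity (Vec.replicate r 0) s ≡ 𝟙 (s ℕₚ.≟ 0) * r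
    multiplicity-replicate zero    s = sym (*-zeroʳ (𝟙 (s ℕₚ.≟ 0)))
    multiplicity-replicate (suc r) s = trans (multiplicity-∷ 0 (Vec.replicate r 0) s)
      (trans (cong (𝟙 (s ℕₚ.≟ 0) +_) (multiplicity-replicate r s)) (sym (ℕₚ.*-suc (𝟙 (s ℕₚ.≟ 0)) r)))

    ∏m!-replicate : (r : ℕ) → ∏m! (Vec.replicate r 0) ≡ r !
    ∏m!-replicate zero    = refl
    ∏m!-replicate (suc r) = trans (∏m!-∷ 0 (Vec.replicate r 0))
      (cong₂ _*_ (trans (multiplicity-replicate (suc r) 0) (+-identityʳ _)) (∏m!-replicate r))

  injections-count : (S : Fin k → Bool) (r : ℕ) → injections S r ≡ 𝟙 (size S ℕₚ.≟ r) * r !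
  injections-count S r = ≡𝟙* (size S ℕₚ.≟ r) sized unsized
    where
    sized : size S ≡ r → injections S r ≡ r !
    sized |S|≡r = trans (injections≡arrangements S r)
      (trans (arrangements-balanced S (Vec.replicate r 0) (λ s → trans (fibreSize≡size S s)
                                                  (trans (cong (𝟙 (s ℕₚ.≟ 0) *_) |S|≡r) (sym (multiplicity-replicate r s)))))
             (∏m!-replicate r))
    unsized : size S ≢ r → injections S r ≡ 0
    unsized |S|≢r with injections S r ℕₚ.≟ 0
    ... | yes none = none
    ... | no  some = ⊥-elim (|S|≢r (begin
      size S                                         ≡⟨ +-identityʳ (size S) ⟨
      𝟙 (0 ℕₚ.≟ 0) * size S                          ≡⟨ fibreSize≡size S 0 ⟨
      fibreSize S 0                                  ≡⟨ arrangements≢0⇒Balanced S (Vec.replicate r 0) (some ∘ trans (injections≡arrangements S r)) 0 ⟩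
      multiplicity (Vec.replicate r 0) 0             ≡⟨ multiplicity-replicate r 0 ⟩
      r + 0                                          ≡⟨ +-identityʳ r ⟩
      r                                              ∎))
      where open ≡-Reasoning

  size-injective-image : {r : ℕ} {S : Fin k → Bool} (v : Vec (Fin k) r) → Distinct v → v ≐ S → size S ≡ r
  size-injective-image {r} {S} v dst v≐S with size S ℕₚ.≟ r
  ... | yes |S|≡r = |S|≡r
  ... | no  |S|≢r = ⊥-elim (ℕₚ.n≮0 (begin
    1                                  ≡⟨ 𝟙-yes (distinct? v ×-dec v ≐? S) (dst , v≐S) ⟨
    𝟙 (distinct? v ×-dec v ≐? S)       ≤⟨ term≤∑ (Vecs r) v _ ⟩
    injections S r                     ≡⟨ injections-count S r ⟩
    𝟙 (size S ℕₚ.≟ r) * r !            ≡⟨ cong (_* r !) (𝟙-no (size S ℕₚ.≟ r) |S|≢r) ⟩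
    0                                  ∎))
    where
    open ℕₚ.≤-Reasoning

𝟙-all-suc : {d : ℕ} {P : Fin (suc d) → Set} (P? : ∀ i → Dec (P i)) →
            𝟙 (Finₚ.all? P?) ≡ 𝟙 (P? zero) * 𝟙 (Finₚ.all? (P? ∘ suc))
𝟙-all-suc P? = trans (𝟙-cong (Finₚ.all? P?) (P? zero ×-dec Finₚ.all? (P? ∘ suc))
                             (λ all → all zero , all ∘ suc) (λ { (p , _) zero → p ; (_ , ps) (suc i) → ps i }))
                     (𝟙-× (P? zero) (Finₚ.all? (P? ∘ suc)))

module _ {n k : ℕ} (S : Fin n → Fin k → Bool) where

  PaletteFamily : {d : ℕ} {rs : Vec ℕ d} → Vec (Fin n) d → All (Vec (Fin k)) rs → Set
  PaletteFamily x s = ∀ i → Distinct (s ‼ i) × s ‼ i ≐ S (lookup x i)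

  paletteFamily? : {d : ℕ} {rs : Vec ℕ d} (x : Vec (Fin n) d) (s : All (Vec (Fin k)) rs) → Dec (PaletteFamily x s)
  paletteFamily? x s = Finₚ.all? (λ i → distinct? (s ‼ i) ×-dec s ‼ i ≐? S (lookup x i))

  Sized : {d : ℕ} → Vec ℕ d → Vec (Fin n) d → Set
  Sized rs x = ∀ i → size (S (lookup x i)) ≡ lookup rs i

  sized? : {d : ℕ} (rs : Vec ℕ d) (x : Vec (Fin n) d) → Dec (Sized rs x)
  sized? rs x = Finₚ.all? (λ i → size (S (lookup x i)) ℕₚ.≟ lookup rs i)

  paletteFamilies : {d : ℕ} (rs : Vec ℕ d) (x : Vec (Fin n) d) →
                    ∑[ s ∈ finite-All (finite-Vec (finite-Fin k)) rs ] 𝟙 (paletteFamily? x s) ≡ 𝟙 (sized? rs x) * ∏r! rs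
  paletteFamilies []       []      = refl
  paletteFamilies (r ∷ rs) (w ∷ x) = begin
    ∑[ s ∈ Palettes (r ∷ rs) ] 𝟙 (paletteFamily? (w ∷ x) s)
      ≡⟨ ∑-All∷ (finite-Vec (finite-Fin k)) r rs _ ⟩
    ∑[ v ∈ finite-Vec (finite-Fin k) r ] ∑[ s ∈ Palettes rs ] 𝟙 (paletteFamily? (w ∷ x) (v ∷ s))
      ≡⟨ ∑-cong (elements (finite-Vec (finite-Fin k) r)) (λ v → ∑-cong (elements (Palettes rs)) (λ s →
           𝟙-all-suc (λ i → distinct? ((v ∷ s) ‼ i) ×-dec (v ∷ s) ‼ i ≐? S (lookup (w ∷ x) i)))) ⟩
    ∑[ v ∈ finite-Vec (finite-Fin k) r ] ∑[ s ∈ Palettes rs ] (𝟙 (distinct? v ×-dec v ≐? S w) * 𝟙 (paletteFamily? x s))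
      ≡⟨ ∑-cong (elements (finite-Vec (finite-Fin k) r)) (λ v → ∑-*ˡ (elements (Palettes rs)) (𝟙 (distinct? v ×-dec v ≐? S w)) _) ⟩
    ∑[ v ∈ finite-Vec (finite-Fin k) r ] (𝟙 (distinct? v ×-dec v ≐? S w) * ∑[ s ∈ Palettes rs ] 𝟙 (paletteFamily? x s))
      ≡⟨ ∑-*ʳ (elements (finite-Vec (finite-Fin k) r)) _ _ ⟩
    injections (S w) r * ∑[ s ∈ Palettes rs ] 𝟙 (paletteFamily? x s)
      ≡⟨ cong₂ _*_ (injections-count (S w) r) (paletteFamilies rs x) ⟩
    (𝟙 (size (S w) ℕₚ.≟ r) * r !) * (𝟙 (sized? rs x) * ∏r! rs)
      ≡⟨ *-interchange (𝟙 (size (S w) ℕₚ.≟ r)) (r !) _ _ ⟩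
    (𝟙 (size (S w) ℕₚ.≟ r) * 𝟙 (sized? rs x)) * (r ! * ∏r! rs)
      ≡⟨ cong (_* (r ! * ∏r! rs)) (𝟙-all-suc (λ i → size (S (lookup (w ∷ x) i)) ℕₚ.≟ lookup (r ∷ rs) i)) ⟨
    𝟙 (sized? (r ∷ rs) (w ∷ x)) * ∏r! (r ∷ rs) ∎
    where
    open ≡-Reasoning
    Palettes : {d : ℕ} (rs : Vec ℕ d) → Finite (All (Vec (Fin k)) rs)
    Palettes = finite-All (finite-Vec (finite-Fin k))

Adjᴴ : {d : ℕ} {rs : Vec ℕ d} → All Fin rs → All Fin rs → Set
Adjᴴ {d} a a′ = Σ (Fin d) λ i → a ‼ i ≢ a′ ‼ i × (∀ j → j ≢ i → a ‼ j ≡ a′ ‼ j)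

module _ {d : ℕ} {rs : Vec ℕ d} where

  Adjᴴ-update : (a : All Fin rs) (i : Fin d) {t t′ : Fin (lookup rs i)} → t ≢ t′ → Adjᴴ (updateᴬ a i t) (updateᴬ a i t′)
  Adjᴴ-update a i {t} {t′} t≢t′ =
    i , (λ e → t≢t′ (trans (sym (‼-updateᴬ a i t)) (trans e (‼-updateᴬ a i t′))))
      , (λ j j≢i → trans (‼-updateᴬ′ a t (j≢i ∘ sym)) (sym (‼-updateᴬ′ a t′ (j≢i ∘ sym))))

  Adjᴴ-update′ : (a : All Fin rs) (i : Fin d) {t : Fin (lookup rs i)} → t ≢ a ‼ i → Adjᴴ a (updateᴬ a i t)
  Adjᴴ-update′ a i {t} t≢aᵢ = subst (λ a′ → Adjᴴ a′ (updateᴬ a i t)) (updateᴬ-id a i) (Adjᴴ-update a i (t≢aᵢ ∘ sym))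

  ¬Adjᴴ-update² : (a : All Fin rs) {i j : Fin d} {t : Fin (lookup rs i)} {u : Fin (lookup rs j)} →
                  i ≢ j → t ≢ a ‼ i → u ≢ a ‼ j → ¬ Adjᴴ a (updateᴬ (updateᴬ a j u) i t)
  ¬Adjᴴ-update² a {i} {j} {t} {u} i≢j t≢aᵢ u≢aⱼ (l , _ , agree) with l Finₚ.≟ i
  ... | no  l≢i  = t≢aᵢ (sym (trans (agree i (l≢i ∘ sym)) (‼-updateᴬ (updateᴬ a j u) i t)))
  ... | yes refl = u≢aⱼ (sym (trans (agree j (i≢j ∘ sym)) (trans (‼-updateᴬ′ (updateᴬ a j u) t i≢j) (‼-updateᴬ a j u))))

origin : {d : ℕ} {rs : Vec ℕ d} → All (2 ≤_) rs → All Fin rs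
origin []                  = []
origin (s≤s (s≤s _) ∷ 2≤rs) = zero ∷ origin 2≤rs

another : {r : ℕ} → 2 ≤ r → Fin r → Fin r
another (s≤s (s≤s _)) zero    = suc zero
another (s≤s (s≤s _)) (suc _) = zero

another-≢ : {r : ℕ} (2≤r : 2 ≤ r) (t : Fin r) → another 2≤r t ≢ t
another-≢ (s≤s (s≤s _)) zero    ()
another-≢ (s≤s (s≤s _)) (suc _) ()

toTab : {k m : ℕ} → (Vec (Fin k) m → Bool) → Tab k m
toTab {m = zero}  f = f []
toTab {m = suc m} f = tabulate (λ a → toTab (λ c → f (a ∷ c)))

mem-toTab : {k m : ℕ} (f : Vec (Fin k) m → Bool) (c : Vec (Fin k) m) → mem (toTab f) c ≡ f c
mem-toTab {m = zero}  f []      = refl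
mem-toTab {m = suc m} f (a ∷ c) = trans (cong (λ t → mem t c) (Vecₚ.lookup∘tabulate _ a)) (mem-toTab (λ c → f (a ∷ c)) c)

Tab-ext : {k m : ℕ} {U U′ : Tab k m} → (∀ c → mem U c ≡ mem U′ c) → U ≡ U′
Tab-ext {m = zero}  eq = eq []
Tab-ext {m = suc m} eq = Vec-ext (λ a → Tab-ext (λ c → eq (a ∷ c)))

module Boxes (n k′ : ℕ) {d : ℕ} (rs : Vec ℕ d) where

  k : ℕ
  k = suc k′

  Coloring Positions Palettes Point : Set
  Coloring  = Vec (Fin k) n
  Positions = Vec (Fin n) d
  Palettes  = All (Vec (Fin k)) rs
  Point     = All Fin rs

  record InBox (x : Positions) (b : Coloring) (s : Palettes) (c : Coloring) : Set where
    constructor inBox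
    field
      outside : ∀ w → ¬ w ∈ᵥ x → lookup c w ≡ lookup b w
      inside  : ∀ i → lookup c (lookup x i) ∈ᵥ s ‼ i
  open InBox

  inBox? : (x : Positions) (b : Coloring) (s : Palettes) (c : Coloring) → Dec (InBox x b s c)
  inBox? x b s c = map′ (λ (o , i) → inBox o i) (λ (inBox o i) → o , i)
    (Finₚ.all? (λ w → ¬? (w ∈ᵥ? x) →-dec (lookup c w Finₚ.≟ lookup b w))
     ×-dec Finₚ.all? (λ i → lookup c (lookup x i) ∈ᵥ? s ‼ i))

  box : Positions → Coloring → Palettes → Tab k n
  box x b s = toTab (λ c → does (inBox? x b s c))

  module _ (x : Positions) (b : Coloring) (s : Palettes) {c : Coloring} where

    ∈box⁺ : InBox x b s c → mem (box x b s) c ≡ true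
    ∈box⁺ c∈ = trans (mem-toTab _ c) (dec-true (inBox? x b s c) c∈)

    ∈box⁻ : mem (box x b s) c ≡ true → InBox x b s c
    ∈box⁻ c∈ = does≡true⇒ (inBox? x b s c) (trans (sym (mem-toTab _ c)) c∈)

  _⊆box_ : Positions × Coloring × Palettes → Positions × Coloring × Palettes → Set
  (x , b , s) ⊆box (x₀ , b₀ , s₀) = ∀ c → InBox x b s c → InBox x₀ b₀ s₀ c

  box-≡⇒⊆ : {x : Positions} {b : Coloring} {s : Palettes} {x₀ : Positions} {b₀ : Coloring} {s₀ : Palettes} →
            box x b s ≡ box x₀ b₀ s₀ → (x , b , s) ⊆box (x₀ , b₀ , s₀)
  box-≡⇒⊆ {x} {b} {s} {x₀} {b₀} {s₀} eq c c∈ = ∈box⁻ x₀ b₀ s₀ (trans (cong (λ U → mem U c) (sym eq)) (∈box⁺ x b s c∈))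

  ⊆⇒box-≡ : {x : Positions} {b : Coloring} {s : Palettes} {x₀ : Positions} {b₀ : Coloring} {s₀ : Palettes} →
            (x , b , s) ⊆box (x₀ , b₀ , s₀) → (x₀ , b₀ , s₀) ⊆box (x , b , s) → box x b s ≡ box x₀ b₀ s₀
  ⊆⇒box-≡ {x} {b} {s} {x₀} {b₀} {s₀} ⊆₀ ⊇₀ = Tab-ext λ c → trans (mem-toTab _ c)
    (trans (does-⇔ (mk⇔ (⊆₀ c) (⊇₀ c)) (inBox? x b s c) (inBox? x₀ b₀ s₀ c)) (sym (mem-toTab _ c)))

  colorAt : (x : Positions) → Coloring → Palettes → Point → (w : Fin n) → Dec (w ∈ᵥ x) → Fin k
  colorAt x b s a w (yes (i , _)) = lookup (s ‼ i) (a ‼ i)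
  colorAt x b s a w (no _)        = lookup b w

  embed : Positions → Coloring → Palettes → Point → Coloring
  embed x b s a = tabulate (λ w → colorAt x b s a w (w ∈ᵥ? x))

  InjectivePalettes : Palettes → Set
  InjectivePalettes s = ∀ i → Distinct (s ‼ i)

  module _ {x : Positions} {b : Coloring} {s : Palettes} where

    embed-outside : (a : Point) {w : Fin n} → ¬ w ∈ᵥ x → lookup (embed x b s a) w ≡ lookup b w
    embed-outside a {w} w∉x = trans (Vecₚ.lookup∘tabulate _ w) (off (w ∈ᵥ? x))
      where
      off : (w∈? : Dec (w ∈ᵥ x)) → colorAt x b s a w w∈? ≡ lookup b w
      off (yes w∈x) = ⊥-elim (w∉x w∈x)
      off (no  _)   = refl

    embed-inside : Distinct x → (a : Point) (i : Fin d) → lookup (embed x b s a) (lookup x i) ≡ lookup (s ‼ i) (a ‼ i)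
    embed-inside dx a i = trans (Vecₚ.lookup∘tabulate _ (lookup x i)) (on (lookup x i ∈ᵥ? x))
      where
      on : (xᵢ∈? : Dec (lookup x i ∈ᵥ x)) → colorAt x b s a (lookup x i) xᵢ∈? ≡ lookup (s ‼ i) (a ‼ i)
      on (yes (j , e)) with dx j i e
      ... | refl = refl
      on (no xᵢ∉x) = ⊥-elim (xᵢ∉x (i , refl))

    embed-InBox : Distinct x → (a : Point) → InBox x b s (embed x b s a)
    embed-InBox dx a = inBox (λ w w∉x → embed-outside a w∉x) (λ i → a ‼ i , sym (embed-inside dx a i))

    InBox⇒embed : Distinct x → (c : Coloring) → InBox x b s c → Σ Point λ a → embed x b s a ≡ c
    InBox⇒embed dx c (inBox c-outside c-inside) = a , Vec-ext agree
      where
      a : Point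
      a = tabulateᴬ (λ i → proj₁ (c-inside i))
      agree : ∀ w → lookup (embed x b s a) w ≡ lookup c w
      agree w with w ∈ᵥ? x
      ... | yes (i , refl) = trans (embed-inside dx a i)
                                   (trans (cong (lookup (s ‼ i)) (‼-tabulateᴬ {rs = rs} _ i)) (proj₂ (c-inside i)))
      ... | no  w∉x       = trans (embed-outside a w∉x) (sym (c-outside w w∉x))

    embed-injective : Distinct x → InjectivePalettes s → (a a′ : Point) → embed x b s a ≡ embed x b s a′ → a ≡ a′
    embed-injective dx ds a a′ eq = ‼-ext λ i →
      ds i _ _ (trans (sym (embed-inside dx a i)) (trans (cong (λ c → lookup c (lookup x i)) eq) (embed-inside dx a′ i)))

    embed-Adj⇒ : Distinct x → InjectivePalettes s → (a a′ : Point) → Adjᴴ a a′ → AdjC (embed x b s a) (embed x b s a′)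
    embed-Adj⇒ dx ds a a′ (i , aᵢ≢a′ᵢ , agree) = lookup x i , differ , agree′
      where
      differ : lookup (embed x b s a) (lookup x i) ≢ lookup (embed x b s a′) (lookup x i)
      differ e = aᵢ≢a′ᵢ (ds i _ _ (trans (sym (embed-inside dx a i)) (trans e (embed-inside dx a′ i))))
      agree′ : ∀ w → w ≢ lookup x i → lookup (embed x b s a) w ≡ lookup (embed x b s a′) w
      agree′ w w≢xᵢ with w ∈ᵥ? x
      ... | yes (j , refl) = trans (embed-inside dx a j)
                                   (trans (cong (lookup (s ‼ j)) (agree j (w≢xᵢ ∘ cong (lookup x)))) (sym (embed-inside dx a′ j)))
      ... | no  w∉x       = trans (embed-outside a w∉x) (sym (embed-outside a′ w∉x))

    embed-Adj⇐ : Distinct x → InjectivePalettes s → (a a′ : Point) → AdjC (embed x b s a) (embed x b s a′) → Adjᴴ a a′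
    embed-Adj⇐ dx ds a a′ (w , differ , agree) with w ∈ᵥ? x
    ... | no  w∉x       = ⊥-elim (differ (trans (embed-outside a w∉x) (sym (embed-outside a′ w∉x))))
    ... | yes (i , refl) =
      i , (λ e → differ (trans (embed-inside dx a i) (trans (cong (lookup (s ‼ i)) e) (sym (embed-inside dx a′ i)))))
        , (λ j j≢i → ds j _ _ (trans (sym (embed-inside dx a j))
                                     (trans (agree (lookup x j) (j≢i ∘ dx j i)) (embed-inside dx a′ j))))

  -- Values of b at the positions are irrelevant to the box; fixing them to zero leaves only
  -- reorderings of the positions and of each palette as ambiguity of the frame.
  Normalized : Positions → Coloring → Set
  Normalized x b = ∀ i → lookup b (lookup x i) ≡ zero

  normalize : Positions → Coloring → Coloring
  normalize x c = tabulate (λ w → if does (w ∈ᵥ? x) then zero else lookup c w)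

  normalize-Normalized : (x : Positions) (c : Coloring) → Normalized x (normalize x c)
  normalize-Normalized x c i rewrite Vecₚ.lookup∘tabulate (λ w → if does (w ∈ᵥ? x) then zero else lookup c w) (lookup x i)
                                   | dec-true (lookup x i ∈ᵥ? x) (i , refl) = refl

  normalize-outside : (x : Positions) (c : Coloring) {w : Fin n} → ¬ w ∈ᵥ x → lookup (normalize x c) w ≡ lookup c w
  normalize-outside x c {w} w∉x rewrite Vecₚ.lookup∘tabulate (λ w → if does (w ∈ᵥ? x) then zero else lookup c w) w
                                      | dec-false (w ∈ᵥ? x) w∉x = refl

  record Structured (x : Positions) (b : Coloring) (s : Palettes) : Set where
    constructor structured
    field
      distinct   : Distinct x
      normalized : Normalized x b
      injective  : InjectivePalettes s

  normalized? : (x : Positions) (b : Coloring) → Dec (Normalized x b)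
  normalized? x b = Finₚ.all? (λ i → lookup b (lookup x i) Finₚ.≟ zero)

  injectivePalettes? : (s : Palettes) → Dec (InjectivePalettes s)
  injectivePalettes? s = Finₚ.all? (λ i → distinct? (s ‼ i))

  structured? : (x : Positions) (b : Coloring) (s : Palettes) → Dec (Structured x b s)
  structured? x b s = map′ (λ (dx , nb , ds) → structured dx nb ds) (λ (structured dx nb ds) → dx , nb , ds)
    (distinct? x ×-dec normalized? x b ×-dec injectivePalettes? s)

  colorsAt : Positions → Palettes → Fin n → Fin k → Bool
  colorsAt x s w = colors (w ∈ᵥ? x)
    where
    colors : Dec (w ∈ᵥ x) → Fin k → Bool
    colors (yes (j , _)) = image (s ‼ j)
    colors (no _)        = λ _ → false

  colorsAt-position : {x : Positions} {s : Palettes} → Distinct x → {j : Fin d} {w : Fin n} → lookup x j ≡ w →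
                       ∀ z → colorsAt x s w z ≡ image (s ‼ j) z
  colorsAt-position {x} dx {j} {w} xⱼ≡w z with w ∈ᵥ? x
  ... | yes (j′ , xⱼ′≡w) with dx j′ j (trans xⱼ′≡w (sym xⱼ≡w))
  ...   | refl = refl
  colorsAt-position {x} dx {j} {w} xⱼ≡w z | no w∉x = ⊥-elim (w∉x (j , xⱼ≡w))

  module Inclusion (2≤rs : All (2 ≤_) rs)
                   {x : Positions} {b : Coloring} {s : Palettes} {x₀ : Positions} {b₀ : Coloring} {s₀ : Palettes}
                   (⊆₀ : (x , b , s) ⊆box (x₀ , b₀ , s₀)) (dx : Distinct x) (ds : InjectivePalettes s) where

    private
      o : Point
      o = origin 2≤rs

      moved : (i : Fin d) → Point
      moved i = updateᴬ o i (another (2≤rs ‼ i) (o ‼ i))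

      inside₀ : (a : Point) → InBox x₀ b₀ s₀ (embed x b s a)
      inside₀ a = ⊆₀ _ (embed-InBox dx a)

    -- Moving coordinate i of the origin changes the color at x ‼ i, so x ‼ i cannot lie outside x₀.
    positions-⊆ : ∀ w → w ∈ᵥ x → w ∈ᵥ x₀
    positions-⊆ w (i , xᵢ≡w) with w ∈ᵥ? x₀
    ... | yes w∈x₀ = w∈x₀
    ... | no  w∉x₀ = ⊥-elim (another-≢ (2≤rs ‼ i) (o ‼ i) (ds i _ _ (begin
      lookup (s ‼ i) (another (2≤rs ‼ i) (o ‼ i))  ≡⟨ cong (lookup (s ‼ i)) (‼-updateᴬ o i _) ⟨
      lookup (s ‼ i) (moved i ‼ i)                 ≡⟨ embed-inside dx (moved i) i ⟨
      lookup (embed x b s (moved i)) (lookup x i)  ≡⟨ cong (lookup (embed x b s (moved i))) xᵢ≡w ⟩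
      lookup (embed x b s (moved i)) w             ≡⟨ outside (inside₀ (moved i)) w w∉x₀ ⟩
      lookup b₀ w                                  ≡⟨ outside (inside₀ o) w w∉x₀ ⟨
      lookup (embed x b s o) w                     ≡⟨ cong (lookup (embed x b s o)) xᵢ≡w ⟨
      lookup (embed x b s o) (lookup x i)          ≡⟨ embed-inside dx o i ⟩
      lookup (s ‼ i) (o ‼ i)                       ∎)))
      where open ≡-Reasoning

    palette-⊆ : ∀ {i j} → lookup x₀ j ≡ lookup x i → ∀ {z} → z ∈ᵥ s ‼ i → z ∈ᵥ s₀ ‼ j
    palette-⊆ {i} {j} x₀ⱼ≡xᵢ (t , sᵢt≡z) =
      let t₀ , e = inside (inside₀ (updateᴬ o i t)) j
      in t₀ , trans e (trans (cong (lookup (embed x b s (updateᴬ o i t))) x₀ⱼ≡xᵢ)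
                      (trans (embed-inside dx (updateᴬ o i t) i) (trans (cong (lookup (s ‼ i)) (‼-updateᴬ o i t)) sᵢt≡z)))

    background-⊆ : ∀ w → ¬ w ∈ᵥ x → ¬ w ∈ᵥ x₀ → lookup b w ≡ lookup b₀ w
    background-⊆ w w∉x w∉x₀ = trans (sym (embed-outside o w∉x)) (outside (inside₀ o) w w∉x₀)

  record SameBox (x : Positions) (b : Coloring) (s : Palettes) (x₀ : Positions) (b₀ : Coloring) (s₀ : Palettes) : Set where
    constructor sameBox
    field
      same-background : b ≡ b₀
      same-positions  : ∀ w → image x w ≡ image x₀ w
      same-palettes   : ∀ i z → image (s ‼ i) z ≡ colorsAt x₀ s₀ (lookup x i) z

  box-≡⇒SameBox : All (2 ≤_) rs → {x : Positions} {b : Coloring} {s : Palettes} {x₀ : Positions} {b₀ : Coloring} {s₀ : Palettes} →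
                  Structured x b s → Structured x₀ b₀ s₀ → box x b s ≡ box x₀ b₀ s₀ → SameBox x b s x₀ b₀ s₀
  box-≡⇒SameBox 2≤rs {x} {b} {s} {x₀} {b₀} {s₀} (structured dx nb ds) (structured dx₀ nb₀ ds₀) eq =
    sameBox (Vec-ext same-background) same-positions same-palettes
    where
    module ⊆ = Inclusion 2≤rs {x} {b} {s} {x₀} {b₀} {s₀} (box-≡⇒⊆ eq) dx ds
    module ⊇ = Inclusion 2≤rs {x₀} {b₀} {s₀} {x} {b} {s} (box-≡⇒⊆ (sym eq)) dx₀ ds₀
    same-positions : ∀ w → image x w ≡ image x₀ w
    same-positions w = does-⇔ (mk⇔ (⊆.positions-⊆ w) (⊇.positions-⊆ w)) (w ∈ᵥ? x) (w ∈ᵥ? x₀)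
    same-background : ∀ w → lookup b w ≡ lookup b₀ w
    same-background w with w ∈ᵥ? x
    ... | yes (i , refl) = let j , x₀ⱼ≡xᵢ = ⊆.positions-⊆ (lookup x i) (i , refl)
                           in trans (nb i) (sym (trans (cong (lookup b₀) (sym x₀ⱼ≡xᵢ)) (nb₀ j)))
    ... | no  w∉x       = ⊆.background-⊆ w w∉x (w∉x ∘ ⊇.positions-⊆ w)
    same-palettes : ∀ i z → image (s ‼ i) z ≡ colorsAt x₀ s₀ (lookup x i) z
    same-palettes i z =
      let j , x₀ⱼ≡xᵢ = ⊆.positions-⊆ (lookup x i) (i , refl)
      in trans (does-⇔ (mk⇔ (⊆.palette-⊆ x₀ⱼ≡xᵢ) (⊇.palette-⊆ (sym x₀ⱼ≡xᵢ))) (z ∈ᵥ? s ‼ i) (z ∈ᵥ? s₀ ‼ j))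
               (sym (colorsAt-position dx₀ x₀ⱼ≡xᵢ z))

  private
    ⊆box-intro : {x : Positions} {b : Coloring} {s : Palettes} {x₀ : Positions} {b₀ : Coloring} {s₀ : Palettes} →
                 b ≡ b₀ → (∀ w → w ∈ᵥ x → w ∈ᵥ x₀) →
                 (∀ j → Σ (Fin d) λ i → lookup x i ≡ lookup x₀ j × (∀ z → z ∈ᵥ s ‼ i → z ∈ᵥ s₀ ‼ j)) →
                 (x , b , s) ⊆box (x₀ , b₀ , s₀)
    ⊆box-intro {x} {s = s} {x₀} {s₀ = s₀} refl x⊆x₀ palettes c (inBox c-outside c-inside) =
      inBox (λ w w∉x₀ → c-outside w (w∉x₀ ∘ x⊆x₀ w)) inside₀
      where
      inside₀ : ∀ j → lookup c (lookup x₀ j) ∈ᵥ s₀ ‼ j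
      inside₀ j = let i , xᵢ≡x₀ⱼ , sᵢ⊆s₀ⱼ = palettes j
                 in sᵢ⊆s₀ⱼ _ (subst (λ w → lookup c w ∈ᵥ s ‼ i) xᵢ≡x₀ⱼ (c-inside i))

  SameBox⇒box-≡ : {x : Positions} {b : Coloring} {s : Palettes} {x₀ : Positions} {b₀ : Coloring} {s₀ : Palettes} →
                  Distinct x → Distinct x₀ → SameBox x b s x₀ b₀ s₀ → box x b s ≡ box x₀ b₀ s₀
  SameBox⇒box-≡ {x} {b} {s} {x₀} {b₀} {s₀} dx dx₀ (sameBox b≡b₀ same-positions same-palettes) =
    ⊆⇒box-≡ {x} {b} {s} {x₀} {b₀} {s₀} (⊆box-intro b≡b₀ x⊆x₀ λ j → let i , e = x₀⊆x (lookup x₀ j) (j , refl) in i , e , s⊆s₀ e)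
                                       (⊆box-intro (sym b≡b₀) x₀⊆x λ i → let j , e = x⊆x₀ (lookup x i) (i , refl) in j , e , s₀⊆s e)
    where
    x⊆x₀ : ∀ w → w ∈ᵥ x → w ∈ᵥ x₀
    x⊆x₀ w w∈x = image⇒∈ x₀ (trans (sym (same-positions w)) (image-∈ x w∈x))
    x₀⊆x : ∀ w → w ∈ᵥ x₀ → w ∈ᵥ x
    x₀⊆x w w∈x₀ = image⇒∈ x (trans (same-positions w) (image-∈ x₀ w∈x₀))
    same : ∀ {i j} → lookup x i ≡ lookup x₀ j → ∀ z → image (s ‼ i) z ≡ image (s₀ ‼ j) z
    same e z = trans (same-palettes _ z) (colorsAt-position dx₀ (sym e) z)
    s⊆s₀ : ∀ {i j} → lookup x i ≡ lookup x₀ j → ∀ z → z ∈ᵥ s ‼ i → z ∈ᵥ s₀ ‼ j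
    s⊆s₀ {i} {j} e z z∈ = image⇒∈ (s₀ ‼ j) (trans (sym (same e z)) (image-∈ (s ‼ i) z∈))
    s₀⊆s : ∀ {i j} → lookup x₀ j ≡ lookup x i → ∀ z → z ∈ᵥ s₀ ‼ j → z ∈ᵥ s ‼ i
    s₀⊆s {i} {j} e z z∈ = image⇒∈ (s ‼ i) (trans (same (sym e) z) (image-∈ (s₀ ‼ j) z∈))

module Representations (n k′ : ℕ) {d : ℕ} (rs : Vec ℕ d) (2≤rs : All (2 ≤_) rs)
                       (Good : Vec (Fin (suc k′)) n → Set) (good? : ∀ c → Dec (Good c)) where
  open Boxes n k′ rs public

  Frame : Set
  Frame = Positions × Coloring × Palettes

  Colorings : Finite Coloring
  Colorings = finite-Vec (finite-Fin k) n

  Frames : Finite Frame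
  Frames = finite-× (finite-Vec (finite-Fin n) d) (finite-× Colorings (finite-All (finite-Vec (finite-Fin k)) rs))

  AllGood : Positions → Coloring → Palettes → Set
  AllGood x b s = ∀ c → InBox x b s c → Good c

  Admissible : Frame → Set
  Admissible (x , b , s) = Structured x b s × AllGood x b s

  admissible? : (φ : Frame) → Dec (Admissible φ)
  admissible? (x , b , s) = structured? x b s ×-dec all? Colorings (λ c → inBox? x b s c →-dec good? c)

  boxOf : Frame → Tab k n
  boxOf (x , b , s) = box x b s

  representations : Tab k n → ℕ
  representations U = ∑[ φ ∈ Frames ] 𝟙 (admissible? φ ×-dec decEq (finite-Tab k n) (boxOf φ) U)

  module _ {x₀ : Positions} {b₀ : Coloring} {s₀ : Palettes} (adm₀ : Admissible (x₀ , b₀ , s₀)) where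

    private
      open Structured (proj₁ adm₀) renaming (distinct to dx₀; normalized to nb₀; injective to ds₀)
      W : Fin n → Bool
      W = image x₀
      S : Fin n → Fin k → Bool
      S = colorsAt x₀ s₀
      open Arrangements (λ w → size (S w)) using (arrangements; isArrangement?; arrangements-balanced; IsArrangement⇒Balanced)

      Equivalent : Frame → Set
      Equivalent (x , b , s) = b ≡ b₀ × (Distinct x × x ≐ W) × PaletteFamily S x s

      equivalent? : (φ : Frame) → Dec (Equivalent φ)
      equivalent? (x , b , s) = decEq Colorings b b₀ ×-dec ((distinct? x ×-dec x ≐? W) ×-dec paletteFamily? S x s)

      same-box⇒Equivalent : (φ : Frame) → Admissible φ × boxOf φ ≡ box x₀ b₀ s₀ → Equivalent φ
      same-box⇒Equivalent (x , b , s) ((str , _) , eq) =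
        let sameBox b≡b₀ x≐W s≐S = box-≡⇒SameBox 2≤rs str (proj₁ adm₀) eq
        in b≡b₀ , (Structured.distinct str , x≐W) , λ i → Structured.injective str i , s≐S i

      Equivalent⇒same-box : (φ : Frame) → Equivalent φ → Admissible φ × boxOf φ ≡ box x₀ b₀ s₀
      Equivalent⇒same-box (x , b , s) (b≡b₀ , (dx , x≐W) , family) =
        (structured dx normalized (proj₁ ∘ family) , λ c c∈ → proj₂ adm₀ c (box-≡⇒⊆ eq c c∈)) , eq
        where
        eq : box x b s ≡ box x₀ b₀ s₀
        eq = SameBox⇒box-≡ dx dx₀ same
          where
          same : SameBox x b s x₀ b₀ s₀
          same = sameBox b≡b₀ x≐W (proj₂ ∘ family)
        normalized : Normalized x b
        normalized i = let j , x₀ⱼ≡xᵢ = image⇒∈ x₀ (trans (sym (x≐W (lookup x i))) (image-∈ x (i , refl)))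
                       in trans (cong (λ b → lookup b (lookup x i)) b≡b₀)
                                (trans (cong (lookup b₀) (sym x₀ⱼ≡xᵢ)) (nb₀ j))

      x₀-sized : ∀ i → size (S (lookup x₀ i)) ≡ lookup rs i
      x₀-sized i = trans (∑-cong (allFin k) (λ z → cong (λ β → 𝟙 (β Boolₚ.≟ true)) (colorsAt-position dx₀ refl z)))
                         (size-injective-image (s₀ ‼ i) (ds₀ i) (λ _ → refl))

      𝟙-equivalent : (φ : Frame) → 𝟙 (admissible? φ ×-dec decEq (finite-Tab k n) (boxOf φ) (box x₀ b₀ s₀)) ≡ 𝟙 (equivalent? φ)
      𝟙-equivalent φ = 𝟙-cong (admissible? φ ×-dec decEq (finite-Tab k n) (boxOf φ) (box x₀ b₀ s₀)) (equivalent? φ)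
                              (same-box⇒Equivalent φ) (Equivalent⇒same-box φ)

      𝟙-arrangement : (x : Positions) →
                      𝟙 (distinct? x ×-dec x ≐? W) * (𝟙 (sized? S rs x) * ∏r! rs) ≡ 𝟙 (isArrangement? W rs x) * ∏r! rs
      𝟙-arrangement x = begin
        𝟙 (distinct? x ×-dec x ≐? W) * (𝟙 (sized? S rs x) * ∏r! rs)          ≡⟨ *-assoc (𝟙 (distinct? x ×-dec x ≐? W)) _ (∏r! rs) ⟨
        𝟙 (distinct? x ×-dec x ≐? W) * 𝟙 (sized? S rs x) * ∏r! rs            ≡⟨ cong (λ e → e * 𝟙 (sized? S rs x) * ∏r! rs)
                                                                                     (𝟙-× (distinct? x) (x ≐? W)) ⟩
        𝟙 (distinct? x) * 𝟙 (x ≐? W) * 𝟙 (sized? S rs x) * ∏r! rs           ≡⟨ cong (_* ∏r! rs) (*-assoc (𝟙 (distinct? x)) _ _) ⟩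
        𝟙 (distinct? x) * (𝟙 (x ≐? W) * 𝟙 (sized? S rs x)) * ∏r! rs         ≡⟨ cong (λ e → 𝟙 (distinct? x) * e * ∏r! rs)
                                                                                     (𝟙-× (x ≐? W) (sized? S rs x)) ⟨
        𝟙 (distinct? x) * 𝟙 (x ≐? W ×-dec sized? S rs x) * ∏r! rs           ≡⟨ cong (_* ∏r! rs) (𝟙-× (distinct? x) (x ≐? W ×-dec sized? S rs x)) ⟨
        𝟙 (isArrangement? W rs x) * ∏r! rs                                   ∎
        where open ≡-Reasoning

    representations-box : representations (box x₀ b₀ s₀) ≡ denom rs
    representations-box = begin
      representations (box x₀ b₀ s₀)
        ≡⟨ ∑-cong (elements Frames) 𝟙-equivalent ⟩
      ∑[ φ ∈ Frames ] 𝟙 (equivalent? φ)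
        ≡⟨ ∑-× Xs BS _ ⟩
      ∑[ x ∈ Xs ] ∑[ bs ∈ BS ] 𝟙 (equivalent? (x , bs))
        ≡⟨ ∑-cong (elements Xs) (λ x → ∑-× Colorings Ss _) ⟩
      ∑[ x ∈ Xs ] ∑[ b ∈ Colorings ] ∑[ s ∈ Ss ] 𝟙 (equivalent? (x , b , s))
        ≡⟨ ∑-cong (elements Xs) (λ x → ∑-cong (elements Colorings) (λ b → ∑-cong (elements Ss) (λ s → split x b s))) ⟩
      ∑[ x ∈ Xs ] ∑[ b ∈ Colorings ] ∑[ s ∈ Ss ] (𝟙 (decEq Colorings b b₀) * (𝟙 (distinct? x ×-dec x ≐? W) * 𝟙 (paletteFamily? S x s)))
        ≡⟨ ∑-cong (elements Xs) (λ x → ∑-cong (elements Colorings) (λ b → ∑-*ˡ (elements Ss) (𝟙 (decEq Colorings b b₀)) _)) ⟩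
      ∑[ x ∈ Xs ] ∑[ b ∈ Colorings ] (𝟙 (decEq Colorings b b₀) * ∑[ s ∈ Ss ] (𝟙 (distinct? x ×-dec x ≐? W) * 𝟙 (paletteFamily? S x s)))
        ≡⟨ ∑-cong (elements Xs) (λ x → ∑-sift Colorings b₀ _) ⟩
      ∑[ x ∈ Xs ] ∑[ s ∈ Ss ] (𝟙 (distinct? x ×-dec x ≐? W) * 𝟙 (paletteFamily? S x s))
        ≡⟨ ∑-cong (elements Xs) (λ x → trans (∑-*ˡ (elements Ss) (𝟙 (distinct? x ×-dec x ≐? W)) _)
                                             (cong (𝟙 (distinct? x ×-dec x ≐? W) *_) (paletteFamilies S rs x))) ⟩
      ∑[ x ∈ Xs ] (𝟙 (distinct? x ×-dec x ≐? W) * (𝟙 (sized? S rs x) * ∏r! rs))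
        ≡⟨ ∑-cong (elements Xs) 𝟙-arrangement ⟩
      ∑[ x ∈ Xs ] (𝟙 (isArrangement? W rs x) * ∏r! rs)
        ≡⟨ ∑-*ʳ (elements Xs) (∏r! rs) _ ⟩
      arrangements W rs * ∏r! rs
        ≡⟨ cong (_* ∏r! rs) (arrangements-balanced W rs (IsArrangement⇒Balanced W rs x₀ (dx₀ , (λ _ → refl) , x₀-sized))) ⟩
      ∏m! rs * ∏r! rs
        ≡⟨ *-comm (∏m! rs) (∏r! rs) ⟩
      denom rs ∎
      where
      open ≡-Reasoning
      Xs : Finite Positions
      Xs = finite-Vec (finite-Fin n) d
      Ss : Finite Palettes
      Ss = finite-All (finite-Vec (finite-Fin k)) rs
      BS : Finite (Coloring × Palettes)
      BS = finite-× Colorings Ss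
      split : ∀ x b s → 𝟙 (equivalent? (x , b , s))
                      ≡ 𝟙 (decEq Colorings b b₀) * (𝟙 (distinct? x ×-dec x ≐? W) * 𝟙 (paletteFamily? S x s))
      split x b s = trans (𝟙-× (decEq Colorings b b₀) ((distinct? x ×-dec x ≐? W) ×-dec paletteFamily? S x s))
                          (cong (𝟙 (decEq Colorings b b₀) *_) (𝟙-× (distinct? x ×-dec x ≐? W) (paletteFamily? S x s)))

  Tabs : Finite (Tab k n)
  Tabs = finite-Tab k n

  IsBox : Tab k n → Set
  IsBox U = Σ Frame λ φ → Admissible φ × boxOf φ ≡ U

  representations≢0⇒IsBox : ∀ U → representations U ≢ 0 → IsBox U
  representations≢0⇒IsBox U ne =
    let φ , _ , term≢0 = ∑≢0⇒∃ (elements Frames) _ ne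
    in φ , 𝟙≢0⇒ (admissible? φ ×-dec decEq Tabs (boxOf φ) U) term≢0

  IsBox⇒representations≢0 : ∀ U → IsBox U → representations U ≢ 0
  IsBox⇒representations≢0 U (φ , adm , refl) none = ℕₚ.n≮0 (begin
    1                                                            ≡⟨ 𝟙-yes (admissible? φ ×-dec decEq Tabs (boxOf φ) U) (adm , refl) ⟨
    𝟙 (admissible? φ ×-dec decEq Tabs (boxOf φ) U)               ≤⟨ term≤∑ Frames φ _ ⟩
    representations U                                            ≡⟨ none ⟩
    0                                                            ∎)
    where
    open ℕₚ.≤-Reasoning

  representations≡𝟙* : ∀ U → representations U ≡ 𝟙 (¬? (representations U ℕₚ.≟ 0)) * denom rs
  representations≡𝟙* U = ≡𝟙* (¬? (representations U ℕₚ.≟ 0))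
    (λ ne → let (x₀ , b₀ , s₀) , adm₀ , box≡U = representations≢0⇒IsBox U ne
            in trans (cong representations (sym box≡U)) (representations-box adm₀))
    (decidable-stable (representations U ℕₚ.≟ 0))

  ∑-representations : ∑[ U ∈ Tabs ] representations U ≡ ∑[ φ ∈ Frames ] 𝟙 (admissible? φ)
  ∑-representations = trans (∑-comm (elements Tabs) (elements Frames) _) (∑-cong (elements Frames) one-box)
    where
    one-box : ∀ φ → ∑[ U ∈ Tabs ] 𝟙 (admissible? φ ×-dec decEq Tabs (boxOf φ) U) ≡ 𝟙 (admissible? φ)
    one-box φ = begin
      ∑[ U ∈ Tabs ] 𝟙 (admissible? φ ×-dec decEq Tabs (boxOf φ) U)
        ≡⟨ ∑-cong (elements Tabs) (λ U → 𝟙-× (admissible? φ) (decEq Tabs (boxOf φ) U)) ⟩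
      ∑[ U ∈ Tabs ] (𝟙 (admissible? φ) * 𝟙 (decEq Tabs (boxOf φ) U))
        ≡⟨ ∑-*ˡ (elements Tabs) (𝟙 (admissible? φ)) _ ⟩
      𝟙 (admissible? φ) * ∑[ U ∈ Tabs ] 𝟙 (decEq Tabs (boxOf φ) U)
        ≡⟨ cong (𝟙 (admissible? φ) *_) (trans (∑-cong (elements Tabs) (λ U → 𝟙-cong (decEq Tabs (boxOf φ) U) (decEq Tabs U (boxOf φ)) sym sym))
                                              (elements-once Tabs (boxOf φ))) ⟩
      𝟙 (admissible? φ) * 1
        ≡⟨ *-identityʳ _ ⟩
      𝟙 (admissible? φ) ∎
      where open ≡-Reasoning

module _ {k n : ℕ} where

  record DiffersOnlyAt (c c′ : Vec (Fin k) n) (v : Fin n) : Set where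
    constructor differsOnlyAt
    field
      differs : lookup c v ≢ lookup c′ v
      agrees  : ∀ w → w ≢ v → lookup c w ≡ lookup c′ w
  open DiffersOnlyAt

  AdjC⇒DiffersOnlyAt : {c c′ : Vec (Fin k) n} (adj : AdjC c c′) → DiffersOnlyAt c c′ (proj₁ adj)
  AdjC⇒DiffersOnlyAt (v , ne , eq) = differsOnlyAt ne eq

  DiffersOnlyAt-sym : {c c′ : Vec (Fin k) n} {v : Fin n} → DiffersOnlyAt c c′ v → DiffersOnlyAt c′ c v
  DiffersOnlyAt-sym (differsOnlyAt ne eq) = differsOnlyAt (ne ∘ sym) (λ w w≢v → sym (eq w w≢v))

  DiffersOnlyAt-unique : {c c′ : Vec (Fin k) n} {v v′ : Fin n} → DiffersOnlyAt c c′ v → DiffersOnlyAt c c′ v′ → v ≡ v′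
  DiffersOnlyAt-unique {v = v} {v′} (differsOnlyAt ne _) (differsOnlyAt _ eq′) with v Finₚ.≟ v′
  ... | yes v≡v′ = v≡v′
  ... | no  v≢v′ = ⊥-elim (ne (eq′ v v≢v′))

  agree-off⇒≡⊎AdjC : {c c′ : Vec (Fin k) n} (v : Fin n) → (∀ w → w ≢ v → lookup c w ≡ lookup c′ w) → c ≡ c′ ⊎ AdjC c c′
  agree-off⇒≡⊎AdjC {c} {c′} v agree with lookup c v Finₚ.≟ lookup c′ v
  ... | no  ne = inj₂ (v , ne , agree)
  ... | yes eq = inj₁ (Vec-ext everywhere)
    where
    everywhere : ∀ w → lookup c w ≡ lookup c′ w
    everywhere w with w Finₚ.≟ v
    ... | yes refl = eq
    ... | no  w≢v  = agree w w≢v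

  triangle-position : {c₁ c₂ c₃ : Vec (Fin k) n} {v w : Fin n} →
                      DiffersOnlyAt c₁ c₂ v → DiffersOnlyAt c₁ c₃ w → AdjC c₂ c₃ → v ≡ w
  triangle-position {c₁} {c₂} {c₃} {v} {w} (differsOnlyAt ne₂ eq₂) (differsOnlyAt ne₃ eq₃) (u , _ , eq₂₃)
    with v Finₚ.≟ w
  ... | yes v≡w = v≡w
  ... | no  v≢w = ⊥-elim (v≢w (trans v≡u (sym w≡u)))
    where
    v≡u : v ≡ u
    v≡u with v Finₚ.≟ u
    ... | yes e   = e
    ... | no  v≢u = ⊥-elim (ne₂ (trans (eq₃ v v≢w) (sym (eq₂₃ v v≢u))))
    w≡u : w ≡ u
    w≡u with w Finₚ.≟ u
    ... | yes e   = e
    ... | no  w≢u = ⊥-elim (ne₃ (trans (eq₂ w (v≢w ∘ sym)) (eq₂₃ w w≢u)))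

  DiffersOnlyAt-between : {c₁ c₂ c₃ : Vec (Fin k) n} {v : Fin n} →
                          DiffersOnlyAt c₁ c₂ v → DiffersOnlyAt c₁ c₃ v → c₂ ≢ c₃ → DiffersOnlyAt c₂ c₃ v
  DiffersOnlyAt-between {c₁} {c₂} {c₃} {v} (differsOnlyAt _ eq₂) (differsOnlyAt _ eq₃) c₂≢c₃ =
    differsOnlyAt (λ e → c₂≢c₃ (Vec-ext (everywhere e))) agree
    where
    agree : ∀ w → w ≢ v → lookup c₂ w ≡ lookup c₃ w
    agree w w≢v = trans (sym (eq₂ w w≢v)) (eq₃ w w≢v)
    everywhere : lookup c₂ v ≡ lookup c₃ v → ∀ w → lookup c₂ w ≡ lookup c₃ w
    everywhere e w with w Finₚ.≟ v
    ... | yes refl = e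
    ... | no  w≢v  = agree w w≢v

  square-opposite : {c₁ c₂ c₃ c₄ : Vec (Fin k) n} {v v′ : Fin n} →
                    DiffersOnlyAt c₁ c₂ v → DiffersOnlyAt c₁ c₄ v′ → AdjC c₂ c₃ → AdjC c₄ c₃ →
                    c₁ ≢ c₃ → ¬ AdjC c₁ c₃ → c₂ ≢ c₄ → DiffersOnlyAt c₄ c₃ v
  square-opposite {c₁} {c₂} {c₃} {c₄} {v} {v′} (differsOnlyAt ne₁₂ eq₁₂) (differsOnlyAt _ eq₁₄)
                  (w , ne₂₃ , eq₂₃) (w′ , ne₄₃ , eq₄₃) c₁≢c₃ c₁≁c₃ c₂≢c₄ with v Finₚ.≟ w′
  ... | yes refl = differsOnlyAt ne₄₃ eq₄₃
  ... | no  v≢w′ = ⊥-elim (c₂≢c₄ (Vec-ext c₂≗c₄))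
    where
    far : ∀ u → (∀ z → z ≢ u → lookup c₁ z ≡ lookup c₃ z) → ⊥
    far u agree with agree-off⇒≡⊎AdjC u agree
    ... | inj₁ c₁≡c₃ = c₁≢c₃ c₁≡c₃
    ... | inj₂ c₁~c₃ = c₁≁c₃ c₁~c₃
    w≢v : w ≢ v
    w≢v refl = far v (λ z z≢v → trans (eq₁₂ z z≢v) (eq₂₃ z z≢v))
    w′≢v′ : w′ ≢ v′
    w′≢v′ refl = far v′ (λ z z≢v′ → trans (eq₁₄ z z≢v′) (eq₄₃ z z≢v′))
    agree₁₃ : ∀ z → z ≢ v′ → z ≢ w′ → lookup c₁ z ≡ lookup c₃ z
    agree₁₃ z z≢v′ z≢w′ = trans (eq₁₄ z z≢v′) (eq₄₃ z z≢w′)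
    v≡v′ : v ≡ v′
    v≡v′ with v Finₚ.≟ v′
    ... | yes e    = e
    ... | no  v≢v′ = ⊥-elim (ne₁₂ (trans (agree₁₃ v v≢v′ v≢w′) (sym (eq₂₃ v (w≢v ∘ sym)))))
    c₂≗c₄ : ∀ z → lookup c₂ z ≡ lookup c₄ z
    c₂≗c₄ z with z Finₚ.≟ v
    ... | yes refl = trans (eq₂₃ z (w≢v ∘ sym)) (sym (eq₄₃ z (λ e → w′≢v′ (trans (sym e) v≡v′))))
    ... | no  z≢v  = trans (sym (eq₁₂ z z≢v)) (eq₁₄ z (λ e → z≢v (trans e (sym v≡v′))))

module HammingEmbedding (n k′ : ℕ) {d : ℕ} (rs : Vec ℕ d) (2≤rs : All (2 ≤_) rs)
                   (f : All Fin rs → Vec (Fin (suc k′)) n)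
                   (f-injective : ∀ a a′ → f a ≡ f a′ → a ≡ a′)
                   (f-adj⇒ : ∀ a a′ → Adjᴴ a a′ → AdjC (f a) (f a′))
                   (f-adj⇐ : ∀ a a′ → AdjC (f a) (f a′) → Adjᴴ a a′) where
  open Boxes n k′ rs
  open DiffersOnlyAt

  private
    o : Point
    o = origin 2≤rs

    o′ : (i : Fin d) → Fin (lookup rs i)
    o′ i = another (2≤rs ‼ i) (o ‼ i)

    o′≢o : (i : Fin d) → o′ i ≢ o ‼ i
    o′≢o i = another-≢ (2≤rs ‼ i) (o ‼ i)

    f-update : (a : Point) (i : Fin d) {t : Fin (lookup rs i)} → t ≢ a ‼ i → AdjC (f a) (f (updateᴬ a i t))
    f-update a i t≢aᵢ = f-adj⇒ a _ (Adjᴴ-update′ a i t≢aᵢ)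

    update-≢ : (a : Point) (i : Fin d) {t t′ : Fin (lookup rs i)} → t ≢ t′ → f (updateᴬ a i t) ≢ f (updateᴬ a i t′)
    update-≢ a i t≢t′ e = t≢t′ (trans (sym (‼-updateᴬ a i _)) (trans (cong (_‼ i) (f-injective _ _ e)) (‼-updateᴬ a i _)))

  position : Fin d → Fin n
  position i = proj₁ (f-update o i (o′≢o i))

  Coordinatewise : Point → Set
  Coordinatewise a = ∀ i (t : Fin (lookup rs i)) → t ≢ a ‼ i → DiffersOnlyAt (f a) (f (updateᴬ a i t)) (position i)

  private
    coordinatewise-origin : Coordinatewise o
    coordinatewise-origin i t t≢oᵢ with f-update o i t≢oᵢ
    ... | w , ne , eq = subst (DiffersOnlyAt (f o) (f (updateᴬ o i t))) (sym position≡w) changed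
      where
      changed : DiffersOnlyAt (f o) (f (updateᴬ o i t)) w
      changed = differsOnlyAt ne eq
      moved : DiffersOnlyAt (f o) (f (updateᴬ o i (o′ i))) (position i)
      moved = AdjC⇒DiffersOnlyAt (f-update o i (o′≢o i))
      position≡w : position i ≡ w
      position≡w with t Finₚ.≟ o′ i
      ... | yes refl  = DiffersOnlyAt-unique moved changed
      ... | no  t≢o′ᵢ = triangle-position moved changed (f-adj⇒ _ _ (Adjᴴ-update o i (t≢o′ᵢ ∘ sym)))

    -- Changing coordinate j first and coordinate i ≢ j afterwards spans an induced 4-cycle.
    coordinatewise-update : ∀ a j u → Coordinatewise a → Coordinatewise (updateᴬ a j u)
    coordinatewise-update a j u cw with u Finₚ.≟ a ‼ j
    ... | yes refl = subst Coordinatewise (sym (updateᴬ-id a j)) cw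
    ... | no  u≢aⱼ = step
      where
      step : Coordinatewise (updateᴬ a j u)
      step i t t≢ with i Finₚ.≟ j
      ... | yes refl = subst (λ a′ → DiffersOnlyAt (f (updateᴬ a i u)) (f a′) (position i)) (sym (updateᴬ-idem a i u t)) same
        where
        t≢u : t ≢ u
        t≢u e = t≢ (trans e (sym (‼-updateᴬ a i u)))
        same : DiffersOnlyAt (f (updateᴬ a i u)) (f (updateᴬ a i t)) (position i)
        same with t Finₚ.≟ a ‼ i
        ... | yes refl = subst (λ a′ → DiffersOnlyAt (f (updateᴬ a i u)) (f a′) (position i)) (sym (updateᴬ-id a i))
                               (DiffersOnlyAt-sym (cw i u u≢aⱼ))
        ... | no  t≢aᵢ = DiffersOnlyAt-between (cw i u u≢aⱼ) (cw i t t≢aᵢ) (update-≢ a i (t≢u ∘ sym))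
      ... | no  i≢j = square-opposite {c₃ = f (updateᴬ (updateᴬ a j u) i t)} (cw i t t≢aᵢ) (cw j u u≢aⱼ)
                        adj₂₃ (f-update (updateᴬ a j u) i t≢) c₁≢c₃ c₁≁c₃ c₂≢c₄
        where
        t≢aᵢ : t ≢ a ‼ i
        t≢aᵢ e = t≢ (trans e (sym (‼-updateᴬ′ a u (i≢j ∘ sym))))
        adj₂₃ : AdjC (f (updateᴬ a i t)) (f (updateᴬ (updateᴬ a j u) i t))
        adj₂₃ = subst (λ a′ → AdjC (f (updateᴬ a i t)) (f a′)) (updateᴬ-comm a t u i≢j)
                      (f-update (updateᴬ a i t) j (λ e → u≢aⱼ (trans e (‼-updateᴬ′ a t i≢j))))
        c₁≢c₃ : f a ≢ f (updateᴬ (updateᴬ a j u) i t)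
        c₁≢c₃ e = t≢aᵢ (sym (trans (cong (_‼ i) (f-injective _ _ e)) (‼-updateᴬ (updateᴬ a j u) i t)))
        c₁≁c₃ : ¬ AdjC (f a) (f (updateᴬ (updateᴬ a j u) i t))
        c₁≁c₃ adj = ¬Adjᴴ-update² a i≢j t≢aᵢ u≢aⱼ (f-adj⇐ _ _ adj)
        c₂≢c₄ : f (updateᴬ a i t) ≢ f (updateᴬ a j u)
        c₂≢c₄ e = t≢aᵢ (trans (sym (‼-updateᴬ a i t)) (trans (cong (_‼ i) (f-injective _ _ e)) (‼-updateᴬ′ a u (i≢j ∘ sym))))

  coordinatewise : ∀ a → Coordinatewise a
  coordinatewise a = updateᴬ-induction Coordinatewise coordinatewise-update o a coordinatewise-origin

  off-positions : ∀ a u → (∀ i → u ≢ position i) → lookup (f a) u ≡ lookup (f o) u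
  off-positions a = updateᴬ-induction (λ a → ∀ u → (∀ i → u ≢ position i) → lookup (f a) u ≡ lookup (f o) u)
    step o a (λ _ _ → refl)
    where
    step : ∀ a j t → (∀ u → (∀ i → u ≢ position i) → lookup (f a) u ≡ lookup (f o) u) →
           ∀ u → (∀ i → u ≢ position i) → lookup (f (updateᴬ a j t)) u ≡ lookup (f o) u
    step a j t off u u∉ with t Finₚ.≟ a ‼ j
    ... | yes refl = subst (λ a′ → lookup (f a′) u ≡ lookup (f o) u) (sym (updateᴬ-id a j)) (off u u∉)
    ... | no  t≢aⱼ = trans (sym (agrees (coordinatewise a j t t≢aⱼ) u (u∉ j))) (off u u∉)

  position-injective : ∀ i j → position i ≡ position j → i ≡ j
  position-injective i j e with i Finₚ.≟ j
  ... | yes i≡j = i≡j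
  ... | no  i≢j with agree-off⇒≡⊎AdjC {c = f o} {c′ = f a₂} (position i) agree
    where
    a₁ a₂ : Point
    a₁ = updateᴬ o i (o′ i)
    a₂ = updateᴬ a₁ j (o′ j)
    agree : ∀ w → w ≢ position i → lookup (f o) w ≡ lookup (f a₂) w
    agree w w≢ = trans (agrees (coordinatewise o i (o′ i) (o′≢o i)) w w≢)
                       (agrees (coordinatewise a₁ j (o′ j) (λ e → o′≢o j (trans e (‼-updateᴬ′ o (o′ i) i≢j))))
                               w (λ e′ → w≢ (trans e′ (sym e))))
  ... | inj₁ fo≡fa₂ = ⊥-elim (o′≢o i (sym (trans (cong (_‼ i) (f-injective _ _ fo≡fa₂))
                        (trans (‼-updateᴬ′ (updateᴬ o i (o′ i)) (o′ j) (i≢j ∘ sym)) (‼-updateᴬ o i (o′ i))))))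
  ... | inj₂ fo~fa₂ = ⊥-elim (¬Adjᴴ-update² o (i≢j ∘ sym) (o′≢o j) (o′≢o i) (f-adj⇐ _ _ fo~fa₂))

  palette : (i : Fin d) → Fin (lookup rs i) → Fin (suc k′)
  palette i t = lookup (f (updateᴬ o i t)) (position i)

  at-position : ∀ a i → lookup (f a) (position i) ≡ palette i (a ‼ i)
  at-position a i = trans (cong (λ a′ → lookup (f a′) (position i)) (sym (updateᴬ-id a i)))
                          (updateᴬ-induction (Through i) (step i) o a (λ _ → refl) (a ‼ i))
    where
    Through : Fin d → Point → Set
    Through i a = ∀ t → lookup (f (updateᴬ a i t)) (position i) ≡ palette i t
    step : ∀ i a j u → Through i a → Through i (updateᴬ a j u)
    step i a j u through t with j Finₚ.≟ i
    ... | yes refl = trans (cong (λ a′ → lookup (f a′) (position j)) (updateᴬ-idem a j u t)) (through t)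
    ... | no  j≢i  = trans (cong (λ a′ → lookup (f a′) (position i)) (updateᴬ-comm a u t j≢i)) (trans unmoved (through t))
      where
      unmoved : lookup (f (updateᴬ (updateᴬ a i t) j u)) (position i) ≡ lookup (f (updateᴬ a i t)) (position i)
      unmoved with u Finₚ.≟ updateᴬ a i t ‼ j
      ... | yes refl = cong (λ a′ → lookup (f a′) (position i)) (updateᴬ-id (updateᴬ a i t) j)
      ... | no  u≢   = sym (agrees (coordinatewise (updateᴬ a i t) j u u≢) (position i) (j≢i ∘ sym ∘ position-injective i j))

  palette-injective : ∀ i t t′ → palette i t ≡ palette i t′ → t ≡ t′
  palette-injective i t t′ e with t Finₚ.≟ t′
  ... | yes t≡t′ = t≡t′
  ... | no  t≢t′ = ⊥-elim (differs (coordinatewise (updateᴬ o i t) i t′ (λ e′ → t≢t′ (sym (trans e′ (‼-updateᴬ o i t)))))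
                                   (trans e (cong (λ a′ → lookup (f a′) (position i)) (sym (updateᴬ-idem o i t t′)))))

  positions : Positions
  positions = tabulate position

  palettes : Palettes
  palettes = tabulateᴬ (λ i → tabulate (palette i))

  background : Coloring
  background = normalize positions (f o)

  private
    lookup-positions : ∀ i → lookup positions i ≡ position i
    lookup-positions = Vecₚ.lookup∘tabulate position

    lookup-palettes : ∀ i t → lookup (palettes ‼ i) t ≡ palette i t
    lookup-palettes i t = trans (cong (λ v → lookup v t) (‼-tabulateᴬ {rs = rs} _ i)) (Vecₚ.lookup∘tabulate (palette i) t)

    off-positions′ : ∀ a {w} → ¬ w ∈ᵥ positions → lookup (f a) w ≡ lookup background w
    off-positions′ a {w} w∉ = trans (off-positions a w (λ i e → w∉ (i , trans (lookup-positions i) (sym e))))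
                                    (sym (normalize-outside positions (f o) w∉))

  structured-frame : Structured positions background palettes
  structured-frame = structured
    (λ i j e → position-injective i j (trans (sym (lookup-positions i)) (trans e (lookup-positions j))))
    (normalize-Normalized positions (f o))
    (λ i t t′ e → palette-injective i t t′ (trans (sym (lookup-palettes i t)) (trans e (lookup-palettes i t′))))

  InBox-f : ∀ a → InBox positions background palettes (f a)
  InBox-f a = inBox (λ w w∉ → off-positions′ a w∉)
                    (λ i → a ‼ i , trans (lookup-palettes i (a ‼ i))
                                         (sym (trans (cong (lookup (f a)) (lookup-positions i)) (at-position a i))))

  InBox⇒f : ∀ c → InBox positions background palettes c → Σ Point λ a → f a ≡ c
  InBox⇒f c (inBox c-outside c-inside) = a , Vec-ext agree
    where
    a : Point
    a = tabulateᴬ (λ i → proj₁ (c-inside i))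
    agree : ∀ u → lookup (f a) u ≡ lookup c u
    agree u with u ∈ᵥ? positions
    ... | no  u∉       = trans (off-positions′ a u∉) (sym (c-outside u u∉))
    ... | yes (i , refl) = begin
      lookup (f a) (lookup positions i)        ≡⟨ cong (lookup (f a)) (lookup-positions i) ⟩
      lookup (f a) (position i)                ≡⟨ at-position a i ⟩
      palette i (a ‼ i)                        ≡⟨ cong (palette i) (‼-tabulateᴬ {rs = rs} _ i) ⟩
      palette i (proj₁ (c-inside i))           ≡⟨ lookup-palettes i _ ⟨
      lookup (palettes ‼ i) (proj₁ (c-inside i)) ≡⟨ proj₂ (c-inside i) ⟩
      lookup c (lookup positions i)            ∎
      where open ≡-Reasoning

module _ {A B C : Gr} where

  Iso-∘ : Iso B C → Iso A B → Iso A C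
  Iso-∘ (g , g-adj) (f , f-adj) = g ↔-∘ f , λ a a′ →
    (λ e → proj₁ (g-adj _ _) (proj₁ (f-adj a a′) e)) , (λ e → proj₂ (f-adj a a′) (proj₂ (g-adj _ _) e))

Iso-sym : {A B : Gr} → Iso A B → Iso B A
Iso-sym {A} {B} (f , f-adj) = ↔-sym f , λ b b′ →
  (λ e → proj₂ (f-adj _ _) (subst₂ (E B) (sym (strictlyInverseˡ b)) (sym (strictlyInverseˡ b′)) e)) ,
  (λ e → subst₂ (E B) (strictlyInverseˡ b) (strictlyInverseˡ b′) (proj₁ (f-adj _ _) e))
  where open Inverse f

Hᴬ : {d : ℕ} → Vec ℕ d → Gr
Hᴬ rs = record { V = All Fin rs ; E = Adjᴴ }

toPoint : {r d : ℕ} {rs : Vec ℕ d} → V (Hgraph (r ∷ rs)) → All Fin (r ∷ rs)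
toPoint {rs = []}     t       = t ∷ []
toPoint {rs = _ ∷ rs} (t , h) = t ∷ toPoint h

fromPoint : {r d : ℕ} {rs : Vec ℕ d} → All Fin (r ∷ rs) → V (Hgraph (r ∷ rs))
fromPoint {rs = []}     (t ∷ [])  = t
fromPoint {rs = _ ∷ rs} (t ∷ ts)  = t , fromPoint ts

toPoint-fromPoint : {r d : ℕ} {rs : Vec ℕ d} (a : All Fin (r ∷ rs)) → toPoint {rs = rs} (fromPoint a) ≡ a
toPoint-fromPoint {rs = []}     (t ∷ []) = refl
toPoint-fromPoint {rs = _ ∷ rs} (t ∷ ts) = cong (t ∷_) (toPoint-fromPoint ts)

fromPoint-toPoint : {r d : ℕ} {rs : Vec ℕ d} (h : V (Hgraph (r ∷ rs))) → fromPoint {rs = rs} (toPoint h) ≡ h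
fromPoint-toPoint {rs = []}     t       = refl
fromPoint-toPoint {rs = _ ∷ rs} (t , h) = cong (t ,_) (fromPoint-toPoint {rs = rs} h)

toPoint-adj⇒ : {r d : ℕ} {rs : Vec ℕ d} (h h′ : V (Hgraph (r ∷ rs))) → E (Hgraph (r ∷ rs)) h h′ → Adjᴴ (toPoint {rs = rs} h) (toPoint {rs = rs} h′)
toPoint-adj⇒ {rs = []} t t′ t≢t′ = zero , t≢t′ , λ { zero 0≢0 → ⊥-elim (0≢0 refl) ; (suc ()) _ }
toPoint-adj⇒ {rs = _ ∷ rs} (t , h) (t′ , h′) (inj₁ (refl , h~h′)) =
  let i , differs , agrees = toPoint-adj⇒ {rs = rs} h h′ h~h′
  in suc i , differs , λ { zero _ → refl ; (suc j) j≢i → agrees j (j≢i ∘ cong suc) }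
toPoint-adj⇒ {rs = _ ∷ rs} (t , h) (t′ , h′) (inj₂ (refl , t≢t′)) =
  zero , t≢t′ , λ { zero 0≢0 → ⊥-elim (0≢0 refl) ; (suc j) _ → refl }

toPoint-adj⇐ : {r d : ℕ} {rs : Vec ℕ d} (h h′ : V (Hgraph (r ∷ rs))) → Adjᴴ (toPoint {rs = rs} h) (toPoint {rs = rs} h′) → E (Hgraph (r ∷ rs)) h h′
toPoint-adj⇐ {rs = []} t t′ (zero , t≢t′ , _) = t≢t′
toPoint-adj⇐ {rs = _ ∷ rs} (t , h) (t′ , h′) (zero , t≢t′ , agrees) = inj₂ (h≡h′ , t≢t′)
  where
  h≡h′ : h ≡ h′
  h≡h′ = trans (sym (fromPoint-toPoint {rs = rs} h))
               (trans (cong fromPoint (‼-ext (λ j → agrees (suc j) λ ()))) (fromPoint-toPoint {rs = rs} h′))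
toPoint-adj⇐ {rs = _ ∷ rs} (t , h) (t′ , h′) (suc i , differs , agrees) =
  inj₁ (agrees zero (λ ()) , toPoint-adj⇐ {rs = rs} h h′ (i , differs , λ j j≢i → agrees (suc j) (j≢i ∘ Finₚ.suc-injective)))

Hgraph≅Hᴬ : {r d : ℕ} (rs : Vec ℕ d) → Iso (Hgraph (r ∷ rs)) (Hᴬ (r ∷ rs))
Hgraph≅Hᴬ rs = mk↔ₛ′ (toPoint {rs = rs}) fromPoint toPoint-fromPoint (fromPoint-toPoint {rs = rs}) ,
               λ h h′ → toPoint-adj⇒ {rs = rs} h h′ , toPoint-adj⇐ {rs = rs} h h′

∈⇒∈ᵥ : {m d : ℕ} {w : Fin m} {x : Vec (Fin m) d} → VecAny.Any (w ≡_) x → w ∈ᵥ x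
∈⇒∈ᵥ (VecAny.here w≡a)  = zero , sym w≡a
∈⇒∈ᵥ (VecAny.there w∈x) = let i , e = ∈⇒∈ᵥ w∈x in suc i , e

∈ᵥ⇒∈ : {m d : ℕ} {w : Fin m} {x : Vec (Fin m) d} → w ∈ᵥ x → VecAny.Any (w ≡_) x
∈ᵥ⇒∈ {x = a ∷ x} (zero  , a≡w) = VecAny.here (sym a≡w)
∈ᵥ⇒∈ {x = a ∷ x} (suc i , e)   = VecAny.there (∈ᵥ⇒∈ (i , e))

_≟ᴸ_ : {m d : ℕ} {rs : Vec ℕ d} → DecidableEquality (Label m d rs)
old w   ≟ᴸ old w′    = map′ (cong old) (λ { refl → refl }) (w Finₚ.≟ w′)
old w   ≟ᴸ new i j   = no λ ()
new i j ≟ᴸ old w     = no λ ()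
new i j ≟ᴸ new i′ j′ with i Finₚ.≟ i′
... | no  i≢i′ = no λ { refl → i≢i′ refl }
... | yes refl = map′ (cong (new i)) (λ { refl → refl }) (j Finₚ.≟ j′)

module Labels (G : Graph) {d : ℕ} (rs : Vec ℕ d) (x : Vec (Fin (n G)) d) where
  open VecMem (Finₚ._≟_ {n G}) using (_∈?_)

  Lab : Set
  Lab = Label (n G) d rs

  ValidLabel : Lab → Set
  ValidLabel (old w)   = ¬ w ∈ᵥ x
  ValidLabel (new _ _) = ⊤

  validLabel? : (l : Lab) → Dec (ValidLabel l)
  validLabel? (old w)   = ¬? (w ∈ᵥ? x)
  validLabel? (new _ _) = yes tt

  label : Fin (length (labels G rs x)) → Lab
  label = List.lookup (labels G rs x)

  count-labels : (l : Lab) → count _≟ᴸ_ (labels G rs x) l ≡ 𝟙 (validLabel? l)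
  count-labels l = begin
    count _≟ᴸ_ (labels G rs x) l
      ≡⟨ ∑-++ (map old outside) (concatMap (λ i → map (new i) (allFin (lookup rs i))) (allFin d)) _ ⟩
    ∑[ l′ ← map old outside ] 𝟙 (l′ ≟ᴸ l) + ∑[ l′ ← concatMap (λ i → map (new i) (allFin (lookup rs i))) (allFin d) ] 𝟙 (l′ ≟ᴸ l)
      ≡⟨ cong₂ _+_ (trans (∑-map outside old _) (∑-filter (allFin (n G)) (λ w → ¬? (w ∈? x)) _))
                   (trans (∑-concatMap (allFin d) _ _) (∑-cong (allFin d) (λ i → ∑-map (allFin (lookup rs i)) (new i) _))) ⟩
    ∑[ w ← allFin (n G) ] (𝟙 (¬? (w ∈? x)) * 𝟙 (old w ≟ᴸ l)) + ∑[ i ← allFin d ] ∑[ j ← allFin (lookup rs i) ] 𝟙 (new i j ≟ᴸ l)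
      ≡⟨ by-kind l ⟩
    𝟙 (validLabel? l) ∎
    where
    open ≡-Reasoning
    outside : List (Fin (n G))
    outside = filter (λ w → ¬? (w ∈? x)) (allFin (n G))
    by-kind : (l : Lab) → ∑[ w ← allFin (n G) ] (𝟙 (¬? (w ∈? x)) * 𝟙 (old w ≟ᴸ l))
                          + ∑[ i ← allFin d ] ∑[ j ← allFin (lookup rs i) ] 𝟙 (new i j ≟ᴸ l) ≡ 𝟙 (validLabel? l)
    by-kind (old w₀) = begin
      ∑[ w ← allFin (n G) ] (𝟙 (¬? (w ∈? x)) * 𝟙 (w Finₚ.≟ w₀)) + ∑[ i ← allFin d ] ∑[ j ← allFin (lookup rs i) ] 0
        ≡⟨ cong₂ _+_ (∑-cong (allFin (n G)) (λ w → *-comm (𝟙 (¬? (w ∈? x))) _)) (∑-zero (allFin d) (λ i → ∑-zero (allFin (lookup rs i)) (λ _ → refl))) ⟩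
      ∑[ w ← allFin (n G) ] (𝟙 (w Finₚ.≟ w₀) * 𝟙 (¬? (w ∈? x))) + 0
        ≡⟨ trans (+-identityʳ _) (∑-sift (finite-Fin (n G)) w₀ _) ⟩
      𝟙 (¬? (w₀ ∈? x))
        ≡⟨ 𝟙-cong (¬? (w₀ ∈? x)) (¬? (w₀ ∈ᵥ? x)) (λ w₀∉ → w₀∉ ∘ ∈ᵥ⇒∈) (λ w₀∉ → w₀∉ ∘ ∈⇒∈ᵥ) ⟩
      𝟙 (¬? (w₀ ∈ᵥ? x)) ∎
    by-kind (new i₀ j₀) = begin
      ∑[ w ← allFin (n G) ] (𝟙 (¬? (w ∈? x)) * 0) + ∑[ i ← allFin d ] ∑[ j ← allFin (lookup rs i) ] 𝟙 (new i j ≟ᴸ new i₀ j₀)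
        ≡⟨ cong₂ _+_ (∑-zero (allFin (n G)) (λ w → *-zeroʳ (𝟙 (¬? (w ∈? x))))) (∑-cong (allFin d) only-i₀) ⟩
      0 + ∑[ i ← allFin d ] 𝟙 (i Finₚ.≟ i₀)
        ≡⟨ elements-once (finite-Fin d) i₀ ⟩
      1 ∎
      where
      only-i₀ : ∀ i → ∑[ j ← allFin (lookup rs i) ] 𝟙 (new i j ≟ᴸ new i₀ j₀) ≡ 𝟙 (i Finₚ.≟ i₀)
      only-i₀ i with i Finₚ.≟ i₀
      ... | yes refl = elements-once (finite-Fin (lookup rs i)) j₀
      ... | no  _    = ∑-zero (allFin (lookup rs i)) (λ _ → refl)

  label-injective : ∀ p q → label p ≡ label q → p ≡ q
  label-injective = lookup-injective _≟ᴸ_ (labels G rs x) (λ l → subst (_≤ 1) (sym (count-labels l)) (𝟙≤1 (validLabel? l)))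

  label-valid : ∀ p → ValidLabel (label p)
  label-valid p = 𝟙≢0⇒ (validLabel? (label p)) (λ e → ℕₚ.n≮0 (subst (1 ≤_) (trans (count-labels (label p)) e) (count-lookup _≟ᴸ_ (labels G rs x) p)))

  index : (l : Lab) → ValidLabel l → Σ (Fin (length (labels G rs x))) λ p → label p ≡ l
  index l valid = count⇒lookup _≟ᴸ_ (labels G rs x) l (≤-reflexive (sym (trans (count-labels l) (𝟙-yes (validLabel? l) valid))))

module BlowupColorings (G : Graph) (simple : SimpleGraph G) (k′ : ℕ) {d : ℕ} (rs : Vec ℕ d) (2≤rs : All (2 ≤_) rs)
                       (x : Vec (Fin (n G)) d) (dx : Distinct x) where
  open Labels G rs x
  open Representations (n G) k′ rs 2≤rs (Proper G) (proper? G)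

  private
    L : ℕ
    L = length (labels G rs x)

    Palettesᶠ : Finite Palettes
    Palettesᶠ = finite-All (finite-Vec (finite-Fin k)) rs

  colorOf : Coloring → Palettes → Lab → Fin k
  colorOf b s (old w)   = lookup b w
  colorOf b s (new i j) = lookup (s ‼ i) j

  toGx : Coloring × Palettes → Vec (Fin k) L
  toGx (b , s) = tabulate (λ p → colorOf b s (label p))

  private
    lookup-toGx : ∀ b s p → lookup (toGx (b , s)) p ≡ colorOf b s (label p)
    lookup-toGx b s p = Vecₚ.lookup∘tabulate _ p

  ProperOnLabels : Coloring → Palettes → Set
  ProperOnLabels b s = ∀ l l′ → ValidLabel l → ValidLabel l′ → T (adjL G rs x l l′) → colorOf b s l ≢ colorOf b s l′

  module _ (b : Coloring) (s : Palettes) where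

    Proper⇒ProperOnLabels : Proper (Gx G rs x) (toGx (b , s)) → ProperOnLabels b s
    Proper⇒ProperOnLabels proper l l′ vl vl′ adj e with index l vl | index l′ vl′
    ... | p , refl | q , refl = proper p q adj (trans (lookup-toGx b s p) (trans e (sym (lookup-toGx b s q))))

    ProperOnLabels⇒Proper : ProperOnLabels b s → Proper (Gx G rs x) (toGx (b , s))
    ProperOnLabels⇒Proper proper p q adj e =
      proper (label p) (label q) (label-valid p) (label-valid q) adj (trans (sym (lookup-toGx b s p)) (trans e (lookup-toGx b s q)))

    ProperOnLabels⇒InjectivePalettes : ProperOnLabels b s → InjectivePalettes s
    ProperOnLabels⇒InjectivePalettes proper i j j′ e with j Finₚ.≟ j′
    ... | yes j≡j′ = j≡j′
    ... | no  j≢j′ = ⊥-elim (proper (new i j) (new i j′) tt tt clique e)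
      where
      clique : T (adjL G rs x (new i j) (new i j′))
      clique = subst T (sym (if-yes (i Finₚ.≟ i) refl)) (T-not⌊⌋ (toℕ j ℕₚ.≟ toℕ j′) (j≢j′ ∘ Finₚ.toℕ-injective))

    ProperOnLabels⇒AllGood : ProperOnLabels b s → AllGood x b s
    ProperOnLabels⇒AllGood proper c (inBox c-outside c-inside) u v adj with u ∈ᵥ? x | v ∈ᵥ? x
    ... | no u∉x | no v∉x = λ e → proper (old u) (old v) u∉x v∉x adj (trans (sym (c-outside u u∉x)) (trans e (c-outside v v∉x)))
    ... | yes (i , refl) | no v∉x =
      let j , sᵢj≡ = c-inside i in λ e → proper (new i j) (old v) tt v∉x adj (trans sᵢj≡ (trans e (c-outside v v∉x)))
    ... | no u∉x | yes (i , refl) =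
      let j , sᵢj≡ = c-inside i in λ e → proper (old u) (new i j) u∉x tt adj (trans (sym (c-outside u u∉x)) (trans e (sym sᵢj≡)))
    ... | yes (i , refl) | yes (i′ , refl) with i Finₚ.≟ i′
    ...   | yes refl = ⊥-elim (subst T (proj₂ simple (lookup x i)) adj)
    ...   | no  i≢i′ =
      let j , sᵢj≡ = c-inside i ; j′ , sᵢ′j′≡ = c-inside i′
      in λ e → proper (new i j) (new i′ j′) tt tt (subst T (sym (if-no (i Finₚ.≟ i′) i≢i′)) adj)
                      (trans sᵢj≡ (trans e (sym sᵢ′j′≡)))

    -- A label pair only ever involves two positions, so a point of H changing at most those two realizes it.
    ProperOnLabels-intro : InjectivePalettes s → AllGood x b s → ProperOnLabels b s
    ProperOnLabels-intro ds good = proper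
      where
      o : Point
      o = origin 2≤rs
      coloring-proper : ∀ a u v → T (adj G u v) → lookup (embed x b s a) u ≢ lookup (embed x b s a) v
      coloring-proper a u v = good (embed x b s a) (embed-InBox dx a) u v
      at : ∀ a i → lookup (embed x b s a) (lookup x i) ≡ lookup (s ‼ i) (a ‼ i)
      at = embed-inside dx
      proper : ProperOnLabels b s
      proper (old w) (old w′) vl vl′ adj e =
        coloring-proper o w w′ adj (trans (embed-outside o vl) (trans e (sym (embed-outside o vl′))))
      proper (old w) (new i j) vl _ adj e =
        coloring-proper (updateᴬ o i j) w (lookup x i) adj
          (trans (embed-outside _ vl) (trans e (sym (trans (at _ i) (cong (lookup (s ‼ i)) (‼-updateᴬ o i j))))))
      proper (new i j) (old w) _ vl′ adj e =
        coloring-proper (updateᴬ o i j) (lookup x i) w adj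
          (trans (trans (at _ i) (cong (lookup (s ‼ i)) (‼-updateᴬ o i j))) (trans e (sym (embed-outside _ vl′))))
      proper (new i j) (new i′ j′) _ _ adj e with i Finₚ.≟ i′
      ... | yes refl = T-not⌊⌋⁻ (toℕ j ℕₚ.≟ toℕ j′) adj (cong toℕ (ds i j j′ e))
      ... | no  i≢i′ = coloring-proper a₂ (lookup x i) (lookup x i′) adj
                         (trans (trans (at a₂ i) (cong (lookup (s ‼ i)) a₂ᵢ)) (trans e (sym (trans (at a₂ i′) (cong (lookup (s ‼ i′)) a₂ᵢ′)))))
        where
        a₂ : Point
        a₂ = updateᴬ (updateᴬ o i j) i′ j′
        a₂ᵢ : a₂ ‼ i ≡ j
        a₂ᵢ = trans (‼-updateᴬ′ (updateᴬ o i j) j′ (i≢i′ ∘ sym)) (‼-updateᴬ o i j)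
        a₂ᵢ′ : a₂ ‼ i′ ≡ j′
        a₂ᵢ′ = ‼-updateᴬ (updateᴬ o i j) i′ j′

  backgroundAt : Vec (Fin k) L → (w : Fin (n G)) → Dec (w ∈ᵥ x) → Fin k
  backgroundAt c w (yes _)   = zero
  backgroundAt c w (no w∉x) = lookup c (proj₁ (index (old w) w∉x))

  fromGx : Vec (Fin k) L → Coloring × Palettes
  fromGx c = tabulate (λ w → backgroundAt c w (w ∈ᵥ? x))
           , tabulateᴬ (λ i → tabulate (λ j → lookup c (proj₁ (index (new i j) tt))))

  private
    fromGx-normalized : ∀ c → Normalized x (proj₁ (fromGx c))
    fromGx-normalized c i = trans (Vecₚ.lookup∘tabulate _ (lookup x i)) (on (lookup x i ∈ᵥ? x))
      where
      on : (xᵢ∈? : Dec (lookup x i ∈ᵥ x)) → backgroundAt c (lookup x i) xᵢ∈? ≡ zero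
      on (yes _)    = refl
      on (no xᵢ∉x) = ⊥-elim (xᵢ∉x (i , refl))

    toGx∘fromGx : ∀ c → toGx (fromGx c) ≡ c
    toGx∘fromGx c = Vec-ext λ p → trans (lookup-toGx _ _ p) (at p (label p) refl)
      where
      at : ∀ p l → label p ≡ l → colorOf (proj₁ (fromGx c)) (proj₂ (fromGx c)) l ≡ lookup c p
      at p (old w) e = trans (Vecₚ.lookup∘tabulate _ w) (off (w ∈ᵥ? x))
        where
        off : (w∈? : Dec (w ∈ᵥ x)) → backgroundAt c w w∈? ≡ lookup c p
        off (yes w∈x) = ⊥-elim (subst ValidLabel e (label-valid p) w∈x)
        off (no  w∉x) = cong (lookup c) (label-injective _ p (trans (proj₂ (index (old w) w∉x)) (sym e)))
      at p (new i j) e = trans (cong (λ v → lookup v j) (‼-tabulateᴬ {rs = rs} _ i))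
        (trans (Vecₚ.lookup∘tabulate _ j) (cong (lookup c) (label-injective _ p (trans (proj₂ (index (new i j) tt)) (sym e)))))

    fromGx∘toGx : ∀ bs → Normalized x (proj₁ bs) → fromGx (toGx bs) ≡ bs
    fromGx∘toGx (b , s) nb = cong₂ _,_ (Vec-ext same-b) (‼-ext same-s)
      where
      same-b : ∀ w → lookup (proj₁ (fromGx (toGx (b , s)))) w ≡ lookup b w
      same-b w = trans (Vecₚ.lookup∘tabulate _ w) (at (w ∈ᵥ? x))
        where
        at : (w∈? : Dec (w ∈ᵥ x)) → backgroundAt (toGx (b , s)) w w∈? ≡ lookup b w
        at (yes (i , xᵢ≡w)) = sym (trans (cong (lookup b) (sym xᵢ≡w)) (nb i))
        at (no  w∉x)       = trans (lookup-toGx b s _) (cong (colorOf b s) (proj₂ (index (old w) w∉x)))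
      same-s : ∀ i → proj₂ (fromGx (toGx (b , s))) ‼ i ≡ s ‼ i
      same-s i = trans (‼-tabulateᴬ {rs = rs} _ i) (Vec-ext λ j →
        trans (Vecₚ.lookup∘tabulate _ j) (trans (lookup-toGx b s _) (cong (colorOf b s) (proj₂ (index (new i j) tt)))))

    𝟙-admissible : ∀ b s → 𝟙 (normalized? x b) * 𝟙 (proper? (Gx G rs x) (toGx (b , s))) ≡ 𝟙 (admissible? (x , b , s))
    𝟙-admissible b s = trans (sym (𝟙-× (normalized? x b) (proper? (Gx G rs x) (toGx (b , s)))))
      (𝟙-cong (normalized? x b ×-dec proper? (Gx G rs x) (toGx (b , s))) (admissible? (x , b , s))
        (λ (nb , proper) → let onLabels = Proper⇒ProperOnLabels b s proper in
                           structured dx nb (ProperOnLabels⇒InjectivePalettes b s onLabels) , ProperOnLabels⇒AllGood b s onLabels)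
        (λ (structured _ nb ds , good) → nb , ProperOnLabels⇒Proper b s (ProperOnLabels-intro b s ds good)))

  π-Gx : π (Gx G rs x) k ≡ ∑[ bs ∈ finite-× Colorings Palettesᶠ ] 𝟙 (admissible? (x , bs))
  π-Gx = begin
    π (Gx G rs x) k
      ≡⟨ sumVec≡∑ L _ ⟩
    ∑[ c ∈ finite-Vec (finite-Fin k) L ] (if ⌊ proper? (Gx G rs x) c ⌋ then 1 else 0)
      ≡⟨ ∑-cong (elements (finite-Vec (finite-Fin k) L)) (if⌊⌋≡𝟙 ∘ proper? (Gx G rs x)) ⟩
    ∑[ c ∈ finite-Vec (finite-Fin k) L ] 𝟙 (proper? (Gx G rs x) c)
      ≡⟨ ∑-reindex (finite-Vec (finite-Fin k) L) (finite-× Colorings Palettesᶠ) (λ bs → normalized? x (proj₁ bs))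
                   toGx fromGx (fromGx-normalized) toGx∘fromGx fromGx∘toGx _ ⟩
    ∑[ bs ∈ finite-× Colorings Palettesᶠ ] (𝟙 (normalized? x (proj₁ bs)) * 𝟙 (proper? (Gx G rs x) (toGx bs)))
      ≡⟨ ∑-cong (elements (finite-× Colorings Palettesᶠ)) (λ (b , s) → 𝟙-admissible b s) ⟩
    ∑[ bs ∈ finite-× Colorings Palettesᶠ ] 𝟙 (admissible? (x , bs)) ∎
    where open ≡-Reasoning

Σ-T-≡ : {P : A → Bool} {a a′ : A} {p : T (P a)} {p′ : T (P a′)} → a ≡ a′ → _≡_ {A = Σ A (T ∘ P)} (a , p) (a′ , p′)
Σ-T-≡ {p = p} {p′} refl = cong (_ ,_) (Boolₚ.T-irrelevant p p′)

module _ (G : Graph) (k : ℕ) {d : ℕ} {rs : Vec ℕ d} (U : Tab k (n G)) (f : All Fin rs → Vec (Fin k) (n G)) where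

  Iso-Induced : (∀ a → T (mem U (f a))) → (∀ c → T (mem U c) → Σ (All Fin rs) λ a → f a ≡ c) →
                (∀ a a′ → f a ≡ f a′ → a ≡ a′) →
                (∀ a a′ → Adjᴴ a a′ → AdjC (f a) (f a′)) → (∀ a a′ → AdjC (f a) (f a′) → Adjᴴ a a′) →
                Iso (Hᴬ rs) (Induced G k U)
  Iso-Induced f-in f-onto f-injective adj⇒ adj⇐ =
    mk↔ₛ′ (λ a → f a , f-in a) (λ (c , c∈) → proj₁ (f-onto c c∈))
          (λ (c , c∈) → Σ-T-≡ {P = mem U} (proj₂ (f-onto c c∈))) (λ a → f-injective _ _ (proj₂ (f-onto (f a) (f-in a)))) ,
    λ a a′ → adj⇒ a a′ , adj⇐ a a′

length-filter : (F : Finite A) {Q : A → Set} (Q? : ∀ a → Dec (Q a)) → length (filter Q? (elements F)) ≡ ∑[ a ∈ F ] 𝟙 (Q? a)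
length-filter F Q? = trans (length≡∑1 (filter Q? (elements F))) (trans (∑-filter (elements F) Q? (λ _ → 1)) (∑-cong (elements F) (λ a → *-identityʳ (𝟙 (Q? a)))))

HasCard-filter : {A : Set} (F : Finite A) {P Q : A → Set} (Q? : ∀ a → Dec (Q a)) → (∀ a → Q a → P a) → (∀ a → P a → Q a) →
                 HasCard P (length (filter Q? (elements F)))
HasCard-filter {A} F Q? Q⇒P P⇒Q = Vec.fromList qs , distinct ,
  λ a → (λ a∈ → Q⇒P a (proj₂ (∈-filter⁻ Q? {xs = elements F} (∈-fromList⁻ a∈)))) , (λ pa → ∈-fromList⁺ (∈-filter⁺ Q? (∈-elements F a) (P⇒Q a pa)))
  where
  qs : List A
  qs = filter Q? (elements F)
  distinct : ∀ i j → lookup (Vec.fromList qs) i ≡ lookup (Vec.fromList qs) j → i ≡ j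
  distinct i j e = lookup-injective (decEq F) qs
    (λ a → ≤-trans (count-filter≤ (decEq F) Q? (elements F) a) (≤-reflexive (elements-once F a)))
    i j (trans (sym (lookup-fromList qs i)) (trans e (lookup-fromList qs j)))

module InducedCopies (G : Graph) (simple : SimpleGraph G) (k′ : ℕ) {d : ℕ} (r : ℕ) (rs : Vec ℕ d) (2≤rs : All (2 ≤_) (r ∷ rs)) where
  open Representations (n G) k′ (r ∷ rs) 2≤rs (Proper G) (proper? G)

  private
    T⇒≡ : {β : Bool} → T β → β ≡ true
    T⇒≡ = Equivalence.to Boolₚ.T-≡
    ≡⇒T : {β : Bool} → β ≡ true → T β
    ≡⇒T = Equivalence.from Boolₚ.T-≡

  box-induces-H : (φ : Frame) → Admissible φ → InducesH G k (r ∷ rs) (boxOf φ)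
  box-induces-H (x , b , s) (structured dx _ ds , good) =
    (λ c c∈ → good c (∈box⁻ x b s (T⇒≡ c∈))) , Iso-∘ {A = Hgraph (r ∷ rs)} {C = Induced G k (box x b s)} Hᴬ≅box (Hgraph≅Hᴬ rs)
    where
    Hᴬ≅box : Iso (Hᴬ (r ∷ rs)) (Induced G k (box x b s))
    Hᴬ≅box = Iso-Induced G k (box x b s) (embed x b s)
      (λ a → ≡⇒T (∈box⁺ x b s (embed-InBox dx a))) (λ c c∈ → InBox⇒embed dx c (∈box⁻ x b s (T⇒≡ c∈)))
      (embed-injective {x} {b} {s} dx ds) (embed-Adj⇒ {x} {b} {s} dx ds) (embed-Adj⇐ {x} {b} {s} dx ds)

  induced-H-is-box : (U : Tab k (n G)) → InducesH G k (r ∷ rs) U → IsBox U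
  induced-H-is-box U (proper , iso) =
    (positions , background , palettes) ,
    (structured-frame , λ c c∈ → proper c (in-U c c∈)) ,
    Tab-ext (λ c → trans (mem-toTab _ c) (does-⇔ (mk⇔ (in-U c) (in-box c)) (inBox? positions background palettes c) (T? (mem U c))))
    where
    Hᴬ≅U : Iso (Hᴬ (r ∷ rs)) (Induced G k U)
    Hᴬ≅U = Iso-∘ {Hᴬ (r ∷ rs)} {Hgraph (r ∷ rs)} {Induced G k U} iso (Iso-sym (Hgraph≅Hᴬ rs))
    open Inverse (proj₁ Hᴬ≅U) renaming (to to g)
    g-adj : ∀ a a′ → (Adjᴴ a a′ → AdjC (proj₁ (g a)) (proj₁ (g a′))) × (AdjC (proj₁ (g a)) (proj₁ (g a′)) → Adjᴴ a a′)
    g-adj = proj₂ Hᴬ≅U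
    f : Point → Coloring
    f = proj₁ ∘ g
    f-injective : ∀ a a′ → f a ≡ f a′ → a ≡ a′
    f-injective a a′ e = trans (sym (strictlyInverseʳ a)) (trans (cong from (Σ-T-≡ {P = mem U} {p = proj₂ (g a)} {p′ = proj₂ (g a′)} e)) (strictlyInverseʳ a′))
    open HammingEmbedding (n G) k′ (r ∷ rs) 2≤rs f f-injective (λ a a′ → proj₁ (g-adj a a′)) (λ a a′ → proj₂ (g-adj a a′))
    in-U : ∀ c → InBox positions background palettes c → T (mem U c)
    in-U c c∈ = let a , fa≡c = InBox⇒f c c∈ in subst (T ∘ mem U) fa≡c (proj₂ (g a))
    in-box : ∀ c → T (mem U c) → InBox positions background palettes c
    in-box c c∈ = subst (InBox positions background palettes) (cong proj₁ (strictlyInverseˡ (c , c∈))) (InBox-f (from (c , c∈)))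

  private
    Represented? : (U : Tab k (n G)) → Dec (representations U ≢ 0)
    Represented? U = ¬? (representations U ℕₚ.≟ 0)

  copies : ℕ
  copies = length (filter Represented? (elements Tabs))

  copies-HasCard : HasCard (InducesH G k (r ∷ rs)) copies
  copies-HasCard = HasCard-filter Tabs Represented?
    (λ U ne → let φ , adm , box≡U = representations≢0⇒IsBox U ne in subst (InducesH G k (r ∷ rs)) box≡U (box-induces-H φ adm))
    (λ U induces → IsBox⇒representations≢0 U (induced-H-is-box U induces))

  copies*denom : copies * denom (r ∷ rs) ≡ sumVec (suc d) (λ x → if ⌊ distinct? x ⌋ then π (Gx G (r ∷ rs) x) k else 0)
  copies*denom = begin
    copies * denom (r ∷ rs)                                     ≡⟨ cong (_* denom (r ∷ rs)) (length-filter Tabs Represented?) ⟩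
    ∑[ U ∈ Tabs ] 𝟙 (Represented? U) * denom (r ∷ rs)          ≡⟨ ∑-*ʳ (elements Tabs) (denom (r ∷ rs)) (𝟙 ∘ Represented?) ⟨
    ∑[ U ∈ Tabs ] (𝟙 (Represented? U) * denom (r ∷ rs))        ≡⟨ ∑-cong (elements Tabs) representations≡𝟙* ⟨
    ∑[ U ∈ Tabs ] representations U                             ≡⟨ ∑-representations ⟩
    ∑[ φ ∈ Frames ] 𝟙 (admissible? φ)                           ≡⟨ ∑-× Xs BS (𝟙 ∘ admissible?) ⟩
    ∑[ x ∈ Xs ] ∑[ bs ∈ BS ] 𝟙 (admissible? (x , bs))           ≡⟨ ∑-cong (elements Xs) per-position ⟩
    ∑[ x ∈ Xs ] (if ⌊ distinct? x ⌋ then π (Gx G (r ∷ rs) x) k else 0)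
                                                                ≡⟨ sumVec≡∑ (suc d) (λ x → if ⌊ distinct? x ⌋ then π (Gx G (r ∷ rs) x) k else 0) ⟨
    sumVec (suc d) (λ x → if ⌊ distinct? x ⌋ then π (Gx G (r ∷ rs) x) k else 0) ∎
    where
    open ≡-Reasoning
    Xs : Finite Positions
    Xs = finite-Vec (finite-Fin (n G)) (suc d)
    BS : Finite (Coloring × Palettes)
    BS = finite-× Colorings (finite-All (finite-Vec (finite-Fin k)) (r ∷ rs))
    per-position : ∀ x → ∑[ bs ∈ BS ] 𝟙 (admissible? (x , bs)) ≡ (if ⌊ distinct? x ⌋ then π (Gx G (r ∷ rs) x) k else 0)
    per-position x with distinct? x
    ... | yes dx = sym (BlowupColorings.π-Gx G simple k′ (r ∷ rs) 2≤rs x dx)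
    ... | no ¬dx = ∑-zero (elements BS) λ bs → 𝟙-no (admissible? (x , bs)) (¬dx ∘ Structured.distinct ∘ proj₁)

lemma2p4 : (G : Graph) → SimpleGraph G →
  (d : ℕ) → 1 ≤ d → (rs : Vec ℕ d) → All (2 ≤_) rs →
  (k : ℕ) → 1 ≤ k →
  Σ ℕ λ c → HasCard (InducesH G k rs) c ×
    (c * denom rs ≡ sumVec d (λ x → if ⌊ distinct? x ⌋ then π (Gx G rs x) k else 0))
lemma2p4 G simple (suc d) _ (r ∷ rs) 2≤rs (suc k′) _ = copies , copies-HasCard , copies*denom
  where open InducedCopies G simple k′ r rs 2≤rs
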